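{- Let $G$ be a graph on $[n]$ and $v\in[n]$ a star vertex of $G$. Then for every combinatorial shifted graph $\Delta^c(G)$ of $G$ there exists a combinatorial shifted graph $\Delta^c(\overline{G-\{v\}})$ of $\overline{G-\{v\}}$ on $[2,n]$ such that \[ E(\Delta^c(G))=E(\Delta^c(\overline{G-\{v\}}))\cup\{\{1,2\},\dots,\{1,1+\deg_G(v)\}\}. \quad (*) \] Conversely, for every combinatorial shifted graph $\Delta^c(\overline{G-\{v\}})$ of $\overline{G-\{v\}}$ there exists a combinatorial shifted graph $\Delta^c(G)$ of $G$ satisfying $(*)$.
   Context: Graphs have no loops or multiple edges; $\deg_G(u)=|\{t:\{u,t\}\in E(G)\}|$. A vertex $v$ is a star vertex of $G$ if $\{u,v\}\in E(G)$ for all $u\ne v$ with $\deg_G(u)>0$. $[2,n]=\{2,\dots,n\}$. $\sigma_{1v}$ is the transposition of $1$ and $v$, and $\sigma_{1v}(G)$ has edges $\{\sigma_{1v}(s),\sigma_{1v}(t)\}$ for $\{s,t\}\in E(G)$; $\overline{G-\{v\}}$ is the induced subgraph of $\sigma_{1v}(G)$ on $[2,n]$. A graph on a totally ordered vertex set $W\subset\mathbb{Z}$ is shifted if for every edge $\{i,j\}$ and all $i'\le i$, $j'\le j$ in $W$ with $i'\ne j'$, $\{i',j'\}$ is an edge. For $i<j$ in the vertex set, $\mathrm{Shift}_{ij}(H)$ has edges $C_{ij}(S)$ for $S\in E(H)$, where $C_{ij}(S)=(S\setminus\{j\})\cup\{i\}$ if $j\in S$, $i\notin S$ and $(S\setminus\{j\})\cup\{i\}\notin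 E(H)$, and $C_{ij}(S)=S$ otherwise. A combinatorial shifted graph of $H$ is any shifted graph $\mathrm{Shift}_{i_qj_q}(\cdots\mathrm{Shift}_{i_1j_1}(H)\cdots)$ with each $i_t<j_t$ vertices of $H$. -}

module Defs where

open import Data.Nat using (ℕ; zero; suc; _+_; _≤_; _<_; _≡ᵇ_)
open import Data.Nat.Properties using (_≤?_)
open import Data.Bool using (Bool; true; false; _∧_; _∨_; not; if_then_else_)
open import Data.Product using (Σ; _×_; _,_; proj₁; proj₂)
open import Data.Sum using (_⊎_)
open import Data.List using (List; []; _∷_; map; filter; length; foldl; upTo)
open import Data.List.Membership.Propositional using (_∈_)
open import Data.List.Relation.Unary.All using (All)
open import Relation.Binary.PropositionalEquality using (_≡_; _≢_)
open import Relation.Nullary using (¬_)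
open import Relation.Unary using (Pred)
open import Function.Bundles using (_⇔_)

-- A graph is given by a finite list of edges; the pair (a , b) stands for
-- the unordered edge {a , b}.  Its edge set E(H) is the set of unordered
-- pairs occurring in the list (duplicates / orientation are irrelevant).
Graph : Set
Graph = List (ℕ × ℕ)

IsEdge : ℕ → ℕ → Graph → Set
IsEdge a b H = ((a , b) ∈ H) ⊎ ((b , a) ∈ H)

edgeᵇ : ℕ → ℕ → Graph → Bool
edgeᵇ a b [] = false
edgeᵇ a b ((s , t) ∷ H) =
  (((a ≡ᵇ s) ∧ (b ≡ᵇ t)) ∨ ((a ≡ᵇ t) ∧ (b ≡ᵇ s))) ∨ edgeᵇ a b H

InInterval : ℕ → ℕ → ℕ → Set
InInterval lo hi x = lo ≤ x × x ≤ hi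

IsGraphOn : ℕ → ℕ → Graph → Set
IsGraphOn lo hi H =
  All (λ e → proj₁ e ≢ proj₂ e × InInterval lo hi (proj₁ e) × InInterval lo hi (proj₂ e)) H

range1 : ℕ → List ℕ
range1 n = map suc (upTo n)

deg : ℕ → Graph → ℕ → ℕ
deg n G u = length (filter (λ t → edgeᵇ u t G Data.Bool.≟ true) (range1 n))
  where import Data.Bool

IsStarVertex : ℕ → Graph → ℕ → Set
IsStarVertex n G v = ∀ u → u ≢ v → 0 < deg n G u → IsEdge u v G

σ : ℕ → ℕ → ℕ
σ v x = if x ≡ᵇ 1 then v else (if x ≡ᵇ v then 1 else x)

σG : ℕ → Graph → Graph
σG v G = map (λ e → σ v (proj₁ e) , σ v (proj₂ e)) G

-- \overline{G - {v}} : induced subgraph of σ_{1v}(G) on [2 , n]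
-- (edges of σ_{1v}(G) lie in [1 , n], so it suffices to drop those meeting 1)
Gbar : ℕ → Graph → Graph
Gbar v G = filter (λ e → (2 ≤? proj₁ e) Relation.Nullary.×-dec (2 ≤? proj₂ e)) (σG v G)
  where import Relation.Nullary

C : ℕ → ℕ → Graph → ℕ × ℕ → ℕ × ℕ
C i j H (s , t) =
  if (s ≡ᵇ j) ∧ (not (t ≡ᵇ i) ∧ not (edgeᵇ i t H)) then (i , t)
  else (if (t ≡ᵇ j) ∧ (not (s ≡ᵇ i) ∧ not (edgeᵇ s i H)) then (s , i)
  else (s , t))

Shift : ℕ → ℕ → Graph → Graph
Shift i j H = map (C i j H) H

applyShifts : List (ℕ × ℕ) → Graph → Graph
applyShifts ps H = foldl (λ K p → Shift (proj₁ p) (proj₂ p) K) H ps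

IsShifted : ℕ → ℕ → Graph → Set
IsShifted lo hi H =
  ∀ i j i' j' → IsEdge i j H →
    InInterval lo hi i' → InInterval lo hi j' → i' ≤ i → j' ≤ j → i' ≢ j' →
    IsEdge i' j' H

ValidShifts : ℕ → ℕ → List (ℕ × ℕ) → Set
ValidShifts lo hi ps =
  All (λ p → proj₁ p < proj₂ p × InInterval lo hi (proj₁ p) × InInterval lo hi (proj₂ p)) ps

IsCombShifted : ℕ → ℕ → Graph → Graph → Set
IsCombShifted lo hi H K =
  Σ (List (ℕ × ℕ)) λ ps → ValidShifts lo hi ps × (K ≡ applyShifts ps H) × IsShifted lo hi K

StarProp : ℕ → Graph → Graph → Set
StarProp d K K' =
  ∀ a b → IsEdge a b K ⇔
    (IsEdge a b K' ⊎
      Σ ℕ λ k → 2 ≤ k × k ≤ suc d × (((a ≡ 1) × (b ≡ k)) ⊎ ((a ≡ k) × (b ≡ 1))))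

-- Graphs are handled through their Boolean adjacency functions, on which Shift_{ij} is a
-- pointwise operation.  Relabelling by σ = σ_{1v} turns G into the cone with apex 1 over
-- Gbar = \overline{G - {v}}, whose link (the neighbourhood of 1) has deg v elements.
--
-- Forward: a shift sequence for G is transported to σ(G) by conjugation, at the price of a
-- relabelling π that is then undone by further shifts, because the final graph K is
-- shifted (each step composes π with the transposition of its least moved point x and π x,
-- lowering Σ |x - π x|²).  On a cone, shifts through the apex do nothing and the others
-- act on base and link separately, so K is the cone over a combinatorial shifted graph K'
-- of Gbar; as K is shifted, its link must be {2, …, deg v + 1}.
--
-- Backward: since v is a star vertex, Shift_{1v} turns G into σ(G); the shifts producing
-- K' are then applied to the base, and finally shifts Shift_{ab} with a outside and b
-- inside the link, which fix the shifted base K', compress the link to {2, …, deg v + 1}.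

module Submission where

open import Defs
open import Data.Nat using (ℕ; zero; suc; _+_; _*_; _∸_; _≤_; _<_; _≡ᵇ_; _≤ᵇ_; ∣_-_∣; z≤n; s≤s; s≤s⁻¹)
open import Data.Nat.Properties
open import Algebra.Properties.CommutativeSemigroup +-commutativeSemigroup using (xy∙z≈xz∙y; xy∙z≈x∙zy)
open import Data.Bool using (Bool; true; false; _∧_; _∨_; not; if_then_else_) renaming (_≟_ to _≟ᴮ_)
open import Data.Bool.Properties using (∨-comm; ∧-comm; ∨-zeroʳ; ∧-zeroʳ; T-≡)
open import Data.Empty using (⊥-elim)
open import Data.Product using (Σ; _×_; _,_; proj₁; proj₂)
open import Data.Sum using (_⊎_; inj₁; inj₂) renaming ([_,_]′ to either)
open import Data.List using (List; []; _∷_; map; filter; length; upTo; _++_)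
open import Data.List.Properties using (map-++; length-++; filter-++; upTo-∷ʳ)
open import Data.List.Relation.Unary.Any using (here; there)
open import Data.List.Relation.Unary.All using ([]; _∷_)
import Data.List.Relation.Unary.All as All
open import Data.List.Relation.Unary.All.Properties using (++⁺)
open import Data.List.Membership.Propositional using (_∈_)
open import Data.List.Membership.Propositional.Properties using (∈-map⁻; ∈-map⁺; ∈-filter⁺; ∈-filter⁻)
open import Function.Bundles using (mk⇔; Equivalence)
open import Relation.Binary.Definitions using (Tri; tri<; tri≈; tri>)
open import Relation.Binary.PropositionalEquality
open import Relation.Nullary using (¬_; ¬?; Dec; yes; no; _×-dec_)
open import Relation.Nullary.Decidable using (decidable-stable)

true≢false : true ≢ false
true≢false ()

≡true-ext : ∀ {a b : Bool} → (a ≡ true → b ≡ true) → (b ≡ true → a ≡ true) → a ≡ b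
≡true-ext {false} {false} f g = refl
≡true-ext {false} {true}  f g = g refl
≡true-ext {true}  {false} f g = sym (f refl)
≡true-ext {true}  {true}  f g = refl

≢true⇒≡false : ∀ {a} → a ≢ true → a ≡ false
≢true⇒≡false {true}  ne = ⊥-elim (ne refl)
≢true⇒≡false {false} ne = refl

∨-introˡ : ∀ {a b} → a ≡ true → (a ∨ b) ≡ true
∨-introˡ refl = refl

∨-introʳ : ∀ {a b} → b ≡ true → (a ∨ b) ≡ true
∨-introʳ {a} refl = ∨-zeroʳ a

∨-elim : ∀ {a b} → (a ∨ b) ≡ true → a ≡ true ⊎ b ≡ true
∨-elim {true}  e = inj₁ refl
∨-elim {false} e = inj₂ e

∧-intro : ∀ {a b} → a ≡ true → b ≡ true → (a ∧ b) ≡ true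
∧-intro refl refl = refl

∧-elim : ∀ {a b} → (a ∧ b) ≡ true → a ≡ true × b ≡ true
∧-elim {true} e = refl , e

∨-absorbˡ : ∀ {a b} → (a ≡ true → b ≡ true) → (a ∨ b) ≡ b
∨-absorbˡ {true}  f = sym (f refl)
∨-absorbˡ {false} f = refl

∨-absorbʳ : ∀ {a b} → (b ≡ true → a ≡ true) → (a ∨ b) ≡ a
∨-absorbʳ {true}          f = refl
∨-absorbʳ {false} {true}  f = sym (f refl)
∨-absorbʳ {false} {false} f = refl

∧-absorbˡ : ∀ {a b} → (a ≡ true → b ≡ true) → (b ∧ a) ≡ a
∧-absorbˡ {true}          f rewrite f refl = refl
∧-absorbˡ {false} {true}  f = refl
∧-absorbˡ {false} {false} f = refl

∧-absorbʳ : ∀ {a b} → (a ≡ true → b ≡ true) → (a ∧ b) ≡ a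
∧-absorbʳ {true}  f = f refl
∧-absorbʳ {false} f = refl

≡ᵇ⇒≡′ : ∀ {x y} → (x ≡ᵇ y) ≡ true → x ≡ y
≡ᵇ⇒≡′ {x} {y} e = ≡ᵇ⇒≡ x y (Equivalence.from T-≡ e)

≡ᵇ-refl : ∀ x → (x ≡ᵇ x) ≡ true
≡ᵇ-refl x = Equivalence.to T-≡ (≡⇒≡ᵇ x x refl)

≢⇒≡ᵇ-false : ∀ {x y} → x ≢ y → (x ≡ᵇ y) ≡ false
≢⇒≡ᵇ-false ne = ≢true⇒≡false (λ e → ne (≡ᵇ⇒≡′ e))

≡ᵇ-false⇒≢ : ∀ {x y} → (x ≡ᵇ y) ≡ false → x ≢ y
≡ᵇ-false⇒≢ {x} e refl = true≢false (trans (sym (≡ᵇ-refl x)) e)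

≤⇒≤ᵇ′ : ∀ {a b} → a ≤ b → (a ≤ᵇ b) ≡ true
≤⇒≤ᵇ′ le = Equivalence.to T-≡ (≤⇒≤ᵇ le)

≤ᵇ⇒≤′ : ∀ {a b} → (a ≤ᵇ b) ≡ true → a ≤ b
≤ᵇ⇒≤′ {a} {b} e = ≤ᵇ⇒≤ a b (Equivalence.from T-≡ e)

≰⇒≤ᵇ-false : ∀ {a b} → ¬ (a ≤ b) → (a ≤ᵇ b) ≡ false
≰⇒≤ᵇ-false ne = ≢true⇒≡false (λ e → ne (≤ᵇ⇒≤′ e))

≢1⇒≥2 : ∀ {a} → 1 ≤ a → a ≢ 1 → 2 ≤ a
≢1⇒≥2 {suc zero}    _ ne = ⊥-elim (ne refl)
≢1⇒≥2 {suc (suc a)} _ ne = s≤s (s≤s z≤n)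

≥2⇒≢1 : ∀ {a} → 2 ≤ a → a ≢ 1
≥2⇒≢1 (s≤s ()) refl

In : ℕ → ℕ → ℕ → Set
In = InInterval

In2⇒In1 : ∀ {n x} → In 2 n x → In 1 n x
In2⇒In1 (2≤x , x≤n) = ≤-trans (s≤s z≤n) 2≤x , x≤n

In1⇒In2 : ∀ {n x} → In 1 n x → x ≢ 1 → In 2 n x
In1⇒In2 (1≤x , x≤n) x≢1 = ≢1⇒≥2 1≤x x≢1 , x≤n

-- Shifting adjacency functions

data Place : Set where
  at-i at-j elsewhere : Place

place : ℕ → ℕ → ℕ → Place
place i j x = if x ≡ᵇ i then at-i else (if x ≡ᵇ j then at-j else elsewhere)

at-i-inv : ∀ {i j x} → place i j x ≡ at-i → x ≡ i
at-i-inv {i} {j} {x} e with x ≡ᵇ i in e₁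
... | true = ≡ᵇ⇒≡′ e₁
... | false with x ≡ᵇ j
at-i-inv () | false | true
at-i-inv () | false | false

at-j-inv : ∀ {i j x} → place i j x ≡ at-j → x ≡ j
at-j-inv {i} {j} {x} e with x ≡ᵇ i
at-j-inv () | true
... | false with x ≡ᵇ j in e₂
... | true = ≡ᵇ⇒≡′ e₂
at-j-inv () | false | false

elsewhere-inv : ∀ {i j x} → place i j x ≡ elsewhere → x ≢ i × x ≢ j
elsewhere-inv {i} {j} {x} e with x ≡ᵇ i in e₁
elsewhere-inv () | true
... | false with x ≡ᵇ j in e₂
elsewhere-inv () | false | true
... | false = ≡ᵇ-false⇒≢ e₁ , ≡ᵇ-false⇒≢ e₂

at-i-subst : ∀ {i j x} (P : ℕ → Set) → place i j x ≡ at-i → P i → P x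
at-i-subst P p = subst P (sym (at-i-inv p))

at-j-subst : ∀ {i j x} (P : ℕ → Set) → place i j x ≡ at-j → P j → P x
at-j-subst P p = subst P (sym (at-j-inv p))

place-i : ∀ i j → place i j i ≡ at-i
place-i i j rewrite ≡ᵇ-refl i = refl

place-j : ∀ {i j} → i ≢ j → place i j j ≡ at-j
place-j {i} {j} ne rewrite ≢⇒≡ᵇ-false (λ e → ne (sym e)) | ≡ᵇ-refl j = refl

place-elsewhere : ∀ {i j x} → x ≢ i → x ≢ j → place i j x ≡ elsewhere
place-elsewhere x≢i x≢j rewrite ≢⇒≡ᵇ-false x≢i | ≢⇒≡ᵇ-false x≢j = refl

Adj : Set
Adj = ℕ → ℕ → Bool

infix 4 _≗₂_
_≗₂_ : Adj → Adj → Set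
r ≗₂ r′ = ∀ x y → r x y ≡ r′ x y

≗₂-refl : ∀ {r} → r ≗₂ r
≗₂-refl x y = refl

≗₂-trans : ∀ {r r′ r″} → r ≗₂ r′ → r′ ≗₂ r″ → r ≗₂ r″
≗₂-trans p q x y = trans (p x y) (q x y)

≗₂-sym : ∀ {r r′} → r ≗₂ r′ → r′ ≗₂ r
≗₂-sym p x y = sym (p x y)

Symmetric : Adj → Set
Symmetric r = ∀ x y → r x y ≡ r y x

Irreflexive : Adj → Set
Irreflexive r = ∀ x → r x x ≡ false

SupportedOn : ℕ → ℕ → Adj → Set
SupportedOn lo hi r = ∀ x y → r x y ≡ true → In lo hi x × In lo hi y

ShiftedOn : ℕ → ℕ → Adj → Set
ShiftedOn lo hi k = ∀ a b a′ b′ → k a b ≡ true → In lo hi a′ → In lo hi b′ →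
  a′ ≤ a → b′ ≤ b → a′ ≢ b′ → k a′ b′ ≡ true

_∘₂_ : Adj → (ℕ → ℕ) → Adj
(r ∘₂ f) x y = r (f x) (f y)

-- After Shift_{ij}, i is adjacent to the union and j to the intersection of the old
-- neighbourhoods of i and j.
shiftAt : ℕ → ℕ → Adj → ℕ → ℕ → Place → Place → Bool
shiftAt i j r x y at-i      at-i      = false
shiftAt i j r x y at-i      at-j      = r i j
shiftAt i j r x y at-i      elsewhere = r i y ∨ r j y
shiftAt i j r x y at-j      at-i      = r j i
shiftAt i j r x y at-j      at-j      = false
shiftAt i j r x y at-j      elsewhere = r j y ∧ r i y
shiftAt i j r x y elsewhere at-i      = r x i ∨ r x j
shiftAt i j r x y elsewhere at-j      = r x j ∧ r x i
shiftAt i j r x y elsewhere elsewhere = r x y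

shift : ℕ → ℕ → Adj → Adj
shift i j r x y = shiftAt i j r x y (place i j x) (place i j y)

shift-sym : ∀ i j r → Symmetric r → Symmetric (shift i j r)
shift-sym i j r s x y with place i j x | place i j y
... | at-i      | at-i      = refl
... | at-i      | at-j      = s i j
... | at-i      | elsewhere = cong₂ _∨_ (s i y) (s j y)
... | at-j      | at-i      = s j i
... | at-j      | at-j      = refl
... | at-j      | elsewhere = cong₂ _∧_ (s j y) (s i y)
... | elsewhere | at-i      = cong₂ _∨_ (s x i) (s x j)
... | elsewhere | at-j      = cong₂ _∧_ (s x j) (s x i)
... | elsewhere | elsewhere = s x y

shift-irreflexive : ∀ i j r → Irreflexive r → Irreflexive (shift i j r)
shift-irreflexive i j r ir x with place i j x
... | at-i      = refl
... | at-j      = refl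
... | elsewhere = ir x

shift-cong : ∀ i j {r r′} → r ≗₂ r′ → shift i j r ≗₂ shift i j r′
shift-cong i j h x y with place i j x | place i j y
... | at-i      | at-i      = refl
... | at-i      | at-j      = h i j
... | at-i      | elsewhere = cong₂ _∨_ (h i y) (h j y)
... | at-j      | at-i      = h j i
... | at-j      | at-j      = refl
... | at-j      | elsewhere = cong₂ _∧_ (h j y) (h i y)
... | elsewhere | at-i      = cong₂ _∨_ (h x i) (h x j)
... | elsewhere | at-j      = cong₂ _∧_ (h x j) (h x i)
... | elsewhere | elsewhere = h x y

shift-supported : ∀ {lo hi i j r} → In lo hi i → In lo hi j → SupportedOn lo hi r →
  SupportedOn lo hi (shift i j r)
shift-supported {lo} {hi} {i} {j} {r} i∈ j∈ sp x y h with place i j x in p₁ | place i j y in p₂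
... | at-i      | at-i      = ⊥-elim (true≢false (sym h))
... | at-j      | at-j      = ⊥-elim (true≢false (sym h))
... | at-i      | at-j      = at-i-subst (In lo hi) p₁ i∈ , at-j-subst (In lo hi) p₂ j∈
... | at-j      | at-i      = at-j-subst (In lo hi) p₁ j∈ , at-i-subst (In lo hi) p₂ i∈
... | at-i      | elsewhere = at-i-subst (In lo hi) p₁ i∈ ,
  either (λ q → proj₂ (sp i y q)) (λ q → proj₂ (sp j y q)) (∨-elim {r i y} h)
... | at-j      | elsewhere = at-j-subst (In lo hi) p₁ j∈ , proj₂ (sp j y (proj₁ (∧-elim {r j y} h)))
... | elsewhere | at-i      =
  either (λ q → proj₁ (sp x i q)) (λ q → proj₁ (sp x j q)) (∨-elim {r x i} h) , at-i-subst (In lo hi) p₂ i∈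
... | elsewhere | at-j      = proj₁ (sp x j (proj₁ (∧-elim {r x j} h))) , at-j-subst (In lo hi) p₂ j∈
... | elsewhere | elsewhere = sp x y h

shifts : List (ℕ × ℕ) → Adj → Adj
shifts []             r = r
shifts ((a , b) ∷ ps) r = shifts ps (shift a b r)

shifts-cong : ∀ ps {r r′} → r ≗₂ r′ → shifts ps r ≗₂ shifts ps r′
shifts-cong []             h = h
shifts-cong ((a , b) ∷ ps) h = shifts-cong ps (shift-cong a b h)

shifts-++ : ∀ xs ys r → shifts (xs ++ ys) r ≡ shifts ys (shifts xs r)
shifts-++ []             ys r = refl
shifts-++ ((a , b) ∷ xs) ys r = shifts-++ xs ys (shift a b r)

shifts-supported : ∀ {lo hi} ps r → ValidShifts lo hi ps → SupportedOn lo hi r →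
  SupportedOn lo hi (shifts ps r)
shifts-supported []             r _                      sp = sp
shifts-supported ((a , b) ∷ ps) r ((_ , a∈ , b∈) ∷ vps) sp =
  shifts-supported ps (shift a b r) vps (shift-supported a∈ b∈ sp)

ShiftedOn-cong : ∀ {lo hi r r′} → r ≗₂ r′ → ShiftedOn lo hi r → ShiftedOn lo hi r′
ShiftedOn-cong e shifted a b a′ b′ h a′∈ b′∈ a′≤a b′≤b a′≢b′ =
  trans (sym (e a′ b′)) (shifted a b a′ b′ (trans (e a b) h) a′∈ b′∈ a′≤a b′≤b a′≢b′)

ValidShifts-weaken : ∀ {n qs} → ValidShifts 2 n qs → ValidShifts 1 n qs
ValidShifts-weaken = All.map (λ (a<b , a∈ , b∈) → a<b , In2⇒In1 a∈ , In2⇒In1 b∈)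

adj : Graph → Adj
adj H a b = edgeᵇ a b H

IsEdge-swap : ∀ {a b H} → IsEdge a b H → IsEdge b a H
IsEdge-swap (inj₁ m) = inj₂ m
IsEdge-swap (inj₂ m) = inj₁ m

IsEdge-subst : ∀ {x y x′ y′ K} → x ≡ x′ → y ≡ y′ → IsEdge x′ y′ K → IsEdge x y K
IsEdge-subst refl refl e = e

IsEdge-there : ∀ {a b e H} → IsEdge a b H → IsEdge a b (e ∷ H)
IsEdge-there (inj₁ m) = inj₁ (there m)
IsEdge-there (inj₂ m) = inj₂ (there m)

edgeᵇ-sound : ∀ a b H → edgeᵇ a b H ≡ true → IsEdge a b H
edgeᵇ-sound a b ((s , t) ∷ H) e with ∨-elim {((a ≡ᵇ s) ∧ (b ≡ᵇ t)) ∨ ((a ≡ᵇ t) ∧ (b ≡ᵇ s))} e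
... | inj₂ e′ = IsEdge-there (edgeᵇ-sound a b H e′)
... | inj₁ e′ with ∨-elim {(a ≡ᵇ s) ∧ (b ≡ᵇ t)} e′
...   | inj₁ e″ = let (p , q) = ∧-elim {a ≡ᵇ s} e″ in inj₁ (here (cong₂ _,_ (≡ᵇ⇒≡′ p) (≡ᵇ⇒≡′ q)))
...   | inj₂ e″ = let (p , q) = ∧-elim {a ≡ᵇ t} e″ in inj₂ (here (cong₂ _,_ (≡ᵇ⇒≡′ q) (≡ᵇ⇒≡′ p)))

edgeᵇ-complete : ∀ a b H → IsEdge a b H → edgeᵇ a b H ≡ true
edgeᵇ-complete a b ((s , t) ∷ H) (inj₁ (here refl)) rewrite ≡ᵇ-refl a | ≡ᵇ-refl b = refl
edgeᵇ-complete a b ((s , t) ∷ H) (inj₂ (here refl)) rewrite ≡ᵇ-refl a | ≡ᵇ-refl b =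
  ∨-introˡ (∨-introʳ {(a ≡ᵇ b) ∧ (b ≡ᵇ a)} refl)
edgeᵇ-complete a b ((s , t) ∷ H) (inj₁ (there m)) = ∨-introʳ (edgeᵇ-complete a b H (inj₁ m))
edgeᵇ-complete a b ((s , t) ∷ H) (inj₂ (there m)) = ∨-introʳ (edgeᵇ-complete a b H (inj₂ m))

adj-sym : ∀ H → Symmetric (adj H)
adj-sym H a b = ≡true-ext (λ h → edgeᵇ-complete b a H (IsEdge-swap (edgeᵇ-sound a b H h)))
                          (λ h → edgeᵇ-complete a b H (IsEdge-swap (edgeᵇ-sound b a H h)))

Loopless : Graph → Set
Loopless H = Irreflexive (adj H)

if-true : ∀ {A : Set} {b} {x y : A} → b ≡ true → (if b then x else y) ≡ x
if-true refl = refl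

if-false : ∀ {A : Set} {b} {x y : A} → b ≡ false → (if b then x else y) ≡ y
if-false refl = refl

guard-true : ∀ a b c → (a ∧ (not b ∧ not c)) ≡ true → a ≡ true × b ≡ false × c ≡ false
guard-true true false false e = refl , refl , refl

guard-false : ∀ a b c → (a ∧ (not b ∧ not c)) ≡ false → a ≡ true → b ≡ false → c ≡ true
guard-false true false true _ _ _ = refl

module _ (i j : ℕ) (H : Graph) where

  KeptFirst KeptSecond : ℕ → ℕ → Set
  KeptFirst  s t = s ≡ j → t ≢ i → adj H i t ≡ true
  KeptSecond s t = t ≡ j → s ≢ i → adj H s i ≡ true

  data CCase (s t : ℕ) : Set where
    moved-first  : C i j H (s , t) ≡ (i , t) → s ≡ j → t ≢ i → adj H i t ≡ false → CCase s t
    moved-second : C i j H (s , t) ≡ (s , i) → t ≡ j → s ≢ i → adj H s i ≡ false →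
                   KeptFirst s t → CCase s t
    kept         : C i j H (s , t) ≡ (s , t) → KeptFirst s t → KeptSecond s t → CCase s t

  C-cases : ∀ s t → CCase s t
  C-cases s t with (s ≡ᵇ j) ∧ (not (t ≡ᵇ i) ∧ not (edgeᵇ i t H)) in e₁
  ... | true with guard-true (s ≡ᵇ j) (t ≡ᵇ i) (edgeᵇ i t H) e₁
  ...   | p , q , r = moved-first (if-true e₁) (≡ᵇ⇒≡′ p) (≡ᵇ-false⇒≢ q) r
  C-cases s t | false with (t ≡ᵇ j) ∧ (not (s ≡ᵇ i) ∧ not (edgeᵇ s i H)) in e₂
  ... | true with guard-true (t ≡ᵇ j) (s ≡ᵇ i) (edgeᵇ s i H) e₂
  ...   | p , q , r = moved-second (trans (if-false e₁) (if-true e₂)) (≡ᵇ⇒≡′ p) (≡ᵇ-false⇒≢ q) r kept₁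
    where
    kept₁ : KeptFirst s t
    kept₁ refl t≢i = guard-false (s ≡ᵇ s) (t ≡ᵇ i) (edgeᵇ i t H) e₁ (≡ᵇ-refl s) (≢⇒≡ᵇ-false t≢i)
  C-cases s t | false | false = kept (trans (if-false e₁) (if-false e₂)) kept₁ kept₂
    where
    kept₁ : KeptFirst s t
    kept₁ refl t≢i = guard-false (s ≡ᵇ s) (t ≡ᵇ i) (edgeᵇ i t H) e₁ (≡ᵇ-refl s) (≢⇒≡ᵇ-false t≢i)
    kept₂ : KeptSecond s t
    kept₂ refl s≢i = guard-false (t ≡ᵇ t) (s ≡ᵇ i) (edgeᵇ s i H) e₂ (≡ᵇ-refl t) (≢⇒≡ᵇ-false s≢i)

module _ (i j : ℕ) (H : Graph) (loopless : Loopless H) (i≢j : i ≢ j) where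
  private
    E = adj H
    E-sym = adj-sym H

  adj-≢ : ∀ {s t} → E s t ≡ true → s ≢ t
  adj-≢ {s} h refl = true≢false (trans (sym h) (loopless s))

  shift-at-C : ∀ s t → (s , t) ∈ H →
    shift i j E (proj₁ (C i j H (s , t))) (proj₂ (C i j H (s , t))) ≡ true
  shift-at-C s t m with edgeᵇ-complete s t H (inj₁ m) | C-cases i j H s t
  ... | est | moved-first eqC refl t≢i _ rewrite eqC | place-i i j
        | place-elsewhere {i} {j} {t} t≢i (λ q → adj-≢ est (sym q)) = ∨-introʳ est
  ... | est | moved-second eqC refl s≢i _ _ rewrite eqC | place-i i j
        | place-elsewhere {i} {j} {s} s≢i (adj-≢ est) = ∨-introʳ est
  ... | est | kept eqC kept₁ kept₂ rewrite eqC with place i j s in p₁ | place i j t in p₂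
  ... | at-i      | at-i      = ⊥-elim (adj-≢ est (trans (at-i-inv p₁) (sym (at-i-inv p₂))))
  ... | at-i      | at-j      = subst₂ (λ a b → E a b ≡ true) (at-i-inv p₁) (at-j-inv p₂) est
  ... | at-i      | elsewhere = ∨-introˡ (subst (λ a → E a t ≡ true) (at-i-inv p₁) est)
  ... | at-j      | at-i      = subst₂ (λ a b → E a b ≡ true) (at-j-inv p₁) (at-i-inv p₂) est
  ... | at-j      | at-j      = ⊥-elim (adj-≢ est (trans (at-j-inv p₁) (sym (at-j-inv p₂))))
  ... | at-j      | elsewhere = ∧-intro (subst (λ a → E a t ≡ true) (at-j-inv p₁) est)
                                        (kept₁ (at-j-inv p₁) (proj₁ (elsewhere-inv p₂)))
  ... | elsewhere | at-i      = ∨-introˡ (subst (λ b → E s b ≡ true) (at-i-inv p₂) est)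
  ... | elsewhere | at-j      = ∧-intro (subst (λ b → E s b ≡ true) (at-j-inv p₂) est)
                                        (kept₂ (at-j-inv p₂) (proj₁ (elsewhere-inv p₁)))
  ... | elsewhere | elsewhere = est

  Shift⊆shift : ∀ x y → IsEdge x y (Shift i j H) → shift i j E x y ≡ true
  Shift⊆shift x y (inj₁ m) with ∈-map⁻ (C i j H) m
  ... | (s , t) , m′ , refl = shift-at-C s t m′
  Shift⊆shift x y (inj₂ m) with ∈-map⁻ (C i j H) m
  ... | (s , t) , m′ , refl = trans (shift-sym i j E E-sym x y) (shift-at-C s t m′)

  kept-in-Shift : ∀ s t → (s , t) ∈ H → ¬ (s ≡ j × t ≢ i × E i t ≡ false) →
    ¬ (t ≡ j × s ≢ i × E s i ≡ false) → (s , t) ∈ Shift i j H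
  kept-in-Shift s t m no₁ no₂ with C-cases i j H s t
  ... | moved-first _ p q r      = ⊥-elim (no₁ (p , q , r))
  ... | moved-second _ p q r _   = ⊥-elim (no₂ (p , q , r))
  ... | kept eqC _ _             = subst (_∈ Shift i j H) eqC (∈-map⁺ (C i j H) m)

  moved-first-in-Shift : ∀ s t → (s , t) ∈ H → s ≡ j → t ≢ i → E i t ≡ false → (i , t) ∈ Shift i j H
  moved-first-in-Shift s t m s≡j t≢i r with C-cases i j H s t
  ... | moved-first eqC _ _ _    = subst (_∈ Shift i j H) eqC (∈-map⁺ (C i j H) m)
  ... | moved-second _ _ _ _ k₁  = ⊥-elim (true≢false (trans (sym (k₁ s≡j t≢i)) r))
  ... | kept _ k₁ _              = ⊥-elim (true≢false (trans (sym (k₁ s≡j t≢i)) r))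

  moved-second-in-Shift : ∀ s t → (s , t) ∈ H → t ≡ j → s ≢ i → E s i ≡ false → s ≢ j →
    (s , i) ∈ Shift i j H
  moved-second-in-Shift s t m t≡j s≢i r s≢j with C-cases i j H s t
  ... | moved-first _ s≡j _ _    = ⊥-elim (s≢j s≡j)
  ... | moved-second eqC _ _ _ _ = subst (_∈ Shift i j H) eqC (∈-map⁺ (C i j H) m)
  ... | kept _ _ k₂              = ⊥-elim (true≢false (trans (sym (k₂ t≡j s≢i)) r))

  Shift-ij : E i j ≡ true → IsEdge i j (Shift i j H)
  Shift-ij h with edgeᵇ-sound i j H h
  ... | inj₁ m = inj₁ (kept-in-Shift i j m (λ (q , _) → i≢j q) (λ (_ , q , _) → q refl))
  ... | inj₂ m = inj₂ (kept-in-Shift j i m (λ (_ , q , _) → q refl) (λ (q , _) → i≢j q))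

  Shift-i-other : ∀ t → t ≢ i → t ≢ j → (E i t ∨ E j t) ≡ true → IsEdge i t (Shift i j H)
  Shift-i-other t t≢i t≢j h with E i t in e
  ... | true with edgeᵇ-sound i t H e
  ...   | inj₁ m = inj₁ (kept-in-Shift i t m (λ (q , _) → i≢j q) (λ (q , _) → t≢j q))
  ...   | inj₂ m = inj₂ (kept-in-Shift t i m (λ (q , _) → t≢j q) (λ (q , _) → i≢j q))
  Shift-i-other t t≢i t≢j h | false with edgeᵇ-sound j t H h
  ...   | inj₁ m = inj₁ (moved-first-in-Shift j t m refl t≢i e)
  ...   | inj₂ m = inj₂ (moved-second-in-Shift t j m refl t≢i (trans (E-sym t i) e) t≢j)

  Shift-j-other : ∀ t → t ≢ i → t ≢ j → (E j t ∧ E i t) ≡ true → IsEdge j t (Shift i j H)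
  Shift-j-other t t≢i t≢j h with ∧-elim {E j t} h
  ... | hj , hi with edgeᵇ-sound j t H hj
  ...   | inj₁ m = inj₁ (kept-in-Shift j t m (λ (_ , _ , q) → true≢false (trans (sym hi) q))
                                             (λ (q , _) → t≢j q))
  ...   | inj₂ m = inj₂ (kept-in-Shift t j m (λ (q , _) → t≢j q)
                                             (λ (_ , _ , q) → true≢false (trans (sym (trans (E-sym t i) hi)) q)))

  Shift-other : ∀ x y → x ≢ i → x ≢ j → y ≢ i → y ≢ j → E x y ≡ true → IsEdge x y (Shift i j H)
  Shift-other x y x≢i x≢j y≢i y≢j h with edgeᵇ-sound x y H h
  ... | inj₁ m = inj₁ (kept-in-Shift x y m (λ (q , _) → x≢j q) (λ (q , _) → y≢j q))
  ... | inj₂ m = inj₂ (kept-in-Shift y x m (λ (q , _) → y≢j q) (λ (q , _) → x≢j q))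

  shift⊆Shift : ∀ x y → shift i j E x y ≡ true → IsEdge x y (Shift i j H)
  shift⊆Shift x y h with place i j x in p₁ | place i j y in p₂
  ... | at-i      | at-i      = ⊥-elim (true≢false (sym h))
  ... | at-j      | at-j      = ⊥-elim (true≢false (sym h))
  ... | at-i      | at-j      = IsEdge-subst (at-i-inv p₁) (at-j-inv p₂) (Shift-ij h)
  ... | at-j      | at-i      =
    IsEdge-subst (at-j-inv p₁) (at-i-inv p₂) (IsEdge-swap (Shift-ij (trans (E-sym i j) h)))
  ... | at-i      | elsewhere = let (y≢i , y≢j) = elsewhere-inv p₂ in
    IsEdge-subst (at-i-inv p₁) refl (Shift-i-other y y≢i y≢j h)
  ... | elsewhere | at-i      = let (x≢i , x≢j) = elsewhere-inv p₁ in
    IsEdge-subst refl (at-i-inv p₂)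
      (IsEdge-swap (Shift-i-other x x≢i x≢j (trans (cong₂ _∨_ (E-sym i x) (E-sym j x)) h)))
  ... | at-j      | elsewhere = let (y≢i , y≢j) = elsewhere-inv p₂ in
    IsEdge-subst (at-j-inv p₁) refl (Shift-j-other y y≢i y≢j h)
  ... | elsewhere | at-j      = let (x≢i , x≢j) = elsewhere-inv p₁ in
    IsEdge-subst refl (at-j-inv p₂)
      (IsEdge-swap (Shift-j-other x x≢i x≢j (trans (cong₂ _∧_ (E-sym j x) (E-sym i x)) h)))
  ... | elsewhere | elsewhere = let (x≢i , x≢j) = elsewhere-inv p₁ ; (y≢i , y≢j) = elsewhere-inv p₂ in
    Shift-other x y x≢i x≢j y≢i y≢j h

  Shift-adj : adj (Shift i j H) ≗₂ shift i j (adj H)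
  Shift-adj x y = ≡true-ext (λ h → Shift⊆shift x y (edgeᵇ-sound x y (Shift i j H) h))
                            (λ h → edgeᵇ-complete x y (Shift i j H) (shift⊆Shift x y h))

  Shift-loopless : Loopless (Shift i j H)
  Shift-loopless x = trans (Shift-adj x x) (shift-irreflexive i j E loopless x)

applyShifts-adj : ∀ {lo hi} ps H → ValidShifts lo hi ps → Loopless H →
  adj (applyShifts ps H) ≗₂ shifts ps (adj H)
applyShifts-adj []             H _                  loopless x y = refl
applyShifts-adj ((a , b) ∷ ps) H ((a<b , _) ∷ vps) loopless =
  ≗₂-trans (applyShifts-adj ps (Shift a b H) vps (Shift-loopless a b H loopless (<⇒≢ a<b)))
           (shifts-cong ps (Shift-adj a b H loopless (<⇒≢ a<b)))

-- Transpositions and relabellings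

τ : ℕ → ℕ → ℕ → ℕ
τ i j x with place i j x
... | at-i      = j
... | at-j      = i
... | elsewhere = x

τ-at-i : ∀ {i j x} → place i j x ≡ at-i → τ i j x ≡ j
τ-at-i p rewrite p = refl

τ-at-j : ∀ {i j x} → place i j x ≡ at-j → τ i j x ≡ i
τ-at-j p rewrite p = refl

τ-elsewhere : ∀ {i j x} → place i j x ≡ elsewhere → τ i j x ≡ x
τ-elsewhere p rewrite p = refl

τ-i : ∀ i j → τ i j i ≡ j
τ-i i j = τ-at-i {i} {j} {i} (place-i i j)

τ-j : ∀ {i j} → i ≢ j → τ i j j ≡ i
τ-j {i} {j} i≢j = τ-at-j {i} {j} {j} (place-j i≢j)

τ-involutive : ∀ {i j} → i ≢ j → ∀ x → τ i j (τ i j x) ≡ x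
τ-involutive {i} {j} i≢j x with place i j x in p
... | at-i      = trans (τ-j i≢j) (sym (at-i-inv p))
... | at-j      = trans (τ-i i j) (sym (at-j-inv p))
... | elsewhere = τ-elsewhere p

module _ (i j : ℕ) (i≢j : i ≢ j) (r : Adj) (r-sym : Symmetric r) (r-irr : Irreflexive r) where

  shift-acts-as-τ : (∀ t → t ≢ i → t ≢ j → r i t ≡ true → r j t ≡ true) → shift i j r ≗₂ r ∘₂ τ i j
  shift-acts-as-τ i⊆j x y with place i j x in p₁ | place i j y in p₂
  ... | at-i      | at-i      = sym (r-irr j)
  ... | at-i      | at-j      = r-sym i j
  ... | at-i      | elsewhere = let (y≢i , y≢j) = elsewhere-inv p₂ in ∨-absorbˡ (i⊆j y y≢i y≢j)
  ... | at-j      | at-i      = r-sym j i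
  ... | at-j      | at-j      = sym (r-irr i)
  ... | at-j      | elsewhere = let (y≢i , y≢j) = elsewhere-inv p₂ in ∧-absorbˡ (i⊆j y y≢i y≢j)
  ... | elsewhere | at-i      = let (x≢i , x≢j) = elsewhere-inv p₁ in
    ∨-absorbˡ (λ h → trans (r-sym x j) (i⊆j x x≢i x≢j (trans (r-sym i x) h)))
  ... | elsewhere | at-j      = let (x≢i , x≢j) = elsewhere-inv p₁ in
    ∧-absorbˡ (λ h → trans (r-sym x j) (i⊆j x x≢i x≢j (trans (r-sym i x) h)))
  ... | elsewhere | elsewhere = refl

  shift-trivial : (∀ t → t ≢ i → t ≢ j → r j t ≡ true → r i t ≡ true) → shift i j r ≗₂ r
  shift-trivial j⊆i x y with place i j x in p₁ | place i j y in p₂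
  ... | at-i      | at-i      = trans (sym (r-irr i)) (cong₂ r (sym (at-i-inv p₁)) (sym (at-i-inv p₂)))
  ... | at-i      | at-j      = cong₂ r (sym (at-i-inv p₁)) (sym (at-j-inv p₂))
  ... | at-i      | elsewhere = let (y≢i , y≢j) = elsewhere-inv p₂ in
    trans (∨-absorbʳ (j⊆i y y≢i y≢j)) (cong (λ a → r a y) (sym (at-i-inv p₁)))
  ... | at-j      | at-i      = cong₂ r (sym (at-j-inv p₁)) (sym (at-i-inv p₂))
  ... | at-j      | at-j      = trans (sym (r-irr j)) (cong₂ r (sym (at-j-inv p₁)) (sym (at-j-inv p₂)))
  ... | at-j      | elsewhere = let (y≢i , y≢j) = elsewhere-inv p₂ in
    trans (∧-absorbʳ (j⊆i y y≢i y≢j)) (cong (λ a → r a y) (sym (at-j-inv p₁)))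
  ... | elsewhere | at-i      = let (x≢i , x≢j) = elsewhere-inv p₁ in
    trans (∨-absorbʳ (λ h → trans (r-sym x i) (j⊆i x x≢i x≢j (trans (r-sym j x) h))))
          (cong (r x) (sym (at-i-inv p₂)))
  ... | elsewhere | at-j      = let (x≢i , x≢j) = elsewhere-inv p₁ in
    trans (∧-absorbʳ (λ h → trans (r-sym x i) (j⊆i x x≢i x≢j (trans (r-sym j x) h))))
          (cong (r x) (sym (at-j-inv p₂)))
  ... | elsewhere | elsewhere = refl

  shift-∘τ : shift i j (r ∘₂ τ i j) ≗₂ shift i j r
  shift-∘τ x y with place i j x in p₁ | place i j y in p₂
  ... | at-i      | at-i      = refl
  ... | at-i      | at-j      = trans (cong₂ r (τ-i i j) (τ-j i≢j)) (r-sym j i)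
  ... | at-i      | elsewhere =
    trans (cong₂ _∨_ (cong₂ r (τ-i i j) (τ-elsewhere p₂)) (cong₂ r (τ-j i≢j) (τ-elsewhere p₂)))
          (∨-comm (r j y) (r i y))
  ... | at-j      | at-i      = trans (cong₂ r (τ-j i≢j) (τ-i i j)) (r-sym i j)
  ... | at-j      | at-j      = refl
  ... | at-j      | elsewhere =
    trans (cong₂ _∧_ (cong₂ r (τ-j i≢j) (τ-elsewhere p₂)) (cong₂ r (τ-i i j) (τ-elsewhere p₂)))
          (∧-comm (r i y) (r j y))
  ... | elsewhere | at-i      =
    trans (cong₂ _∨_ (cong₂ r (τ-elsewhere p₁) (τ-i i j)) (cong₂ r (τ-elsewhere p₁) (τ-j i≢j)))
          (∨-comm (r x j) (r x i))
  ... | elsewhere | at-j      =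
    trans (cong₂ _∧_ (cong₂ r (τ-elsewhere p₁) (τ-j i≢j)) (cong₂ r (τ-elsewhere p₁) (τ-i i j)))
          (∧-comm (r x i) (r x j))
  ... | elsewhere | elsewhere = cong₂ r (τ-elsewhere p₁) (τ-elsewhere p₂)

≡ᵇ-relabel : ∀ (f : ℕ → ℕ) {g : ℕ → ℕ} → (∀ x → g (f x) ≡ x) → ∀ x a → (f x ≡ᵇ f a) ≡ (x ≡ᵇ a)
≡ᵇ-relabel f {g} g∘f x a = ≡true-ext
  (λ h → subst (λ z → (z ≡ᵇ a) ≡ true)
                (trans (sym (g∘f a)) (trans (cong g (sym (≡ᵇ⇒≡′ h))) (g∘f x))) (≡ᵇ-refl a))
  (λ h → subst (λ z → (f z ≡ᵇ f a) ≡ true) (sym (≡ᵇ⇒≡′ h)) (≡ᵇ-refl (f a)))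

place-relabel : ∀ (f : ℕ → ℕ) {g : ℕ → ℕ} → (∀ x → g (f x) ≡ x) → ∀ a b x →
  place (f a) (f b) (f x) ≡ place a b x
place-relabel f {g} g∘f a b x rewrite ≡ᵇ-relabel f {g} g∘f x a | ≡ᵇ-relabel f {g} g∘f x b = refl

shift-relabel : ∀ (f : ℕ → ℕ) {g : ℕ → ℕ} → (∀ x → g (f x) ≡ x) → ∀ a b M →
  shift a b (M ∘₂ f) ≗₂ shift (f a) (f b) M ∘₂ f
shift-relabel f {g} g∘f a b M x y
  rewrite place-relabel f {g} g∘f a b x | place-relabel f {g} g∘f a b y with place a b x | place a b y
... | at-i      | at-i      = refl
... | at-i      | at-j      = refl
... | at-i      | elsewhere = refl
... | at-j      | at-i      = refl
... | at-j      | at-j      = refl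
... | at-j      | elsewhere = refl
... | elsewhere | at-i      = refl
... | elsewhere | at-j      = refl
... | elsewhere | elsewhere = refl

shift-flip : ∀ p q → p ≢ q → (M : Adj) → Symmetric M → Irreflexive M →
  shift q p M ≗₂ shift p q M ∘₂ τ p q
shift-flip p q p≢q M M-sym M-irr x y = begin
  shift q p M x y                                           ≡⟨ sym (cong₂ (shift q p M) (inv x) (inv y)) ⟩
  shift q p M (τ p q (τ p q x)) (τ p q (τ p q y))
    ≡⟨ cong₂ (λ a b → shift a b M (τ p q (τ p q x)) (τ p q (τ p q y))) (sym (τ-i p q)) (sym (τ-j p≢q)) ⟩
  shift (τ p q p) (τ p q q) M (τ p q (τ p q x)) (τ p q (τ p q y))
    ≡⟨ sym (shift-relabel (τ p q) {τ p q} inv p q M (τ p q x) (τ p q y)) ⟩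
  shift p q (M ∘₂ τ p q) (τ p q x) (τ p q y)                ≡⟨ shift-∘τ p q p≢q M M-sym M-irr (τ p q x) (τ p q y) ⟩
  shift p q M (τ p q x) (τ p q y)                           ∎
  where
  open ≡-Reasoning
  inv = τ-involutive p≢q

module _ (f : ℕ → ℕ) {g : ℕ → ℕ} (f∘g : ∀ x → f (g x) ≡ x) (M : Adj) {r : Adj} (r≗ : r ≗₂ M ∘₂ f) where

  unrelabel : M ≗₂ r ∘₂ g
  unrelabel x y = trans (cong₂ M (sym (f∘g x)) (sym (f∘g y))) (sym (r≗ (g x) (g y)))

  unrelabel-sym : Symmetric r → Symmetric M
  unrelabel-sym r-sym x y = trans (unrelabel x y) (trans (r-sym (g x) (g y)) (sym (unrelabel y x)))

  unrelabel-irreflexive : Irreflexive r → Irreflexive M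
  unrelabel-irreflexive r-irr x = trans (unrelabel x x) (r-irr (g x))

sumBelow : ℕ → (ℕ → ℕ) → ℕ
sumBelow zero    h = 0
sumBelow (suc N) h = sumBelow N h + h N

sumBelow-cong : ∀ N {h h′} → (∀ z → z < N → h z ≡ h′ z) → sumBelow N h ≡ sumBelow N h′
sumBelow-cong zero    e = refl
sumBelow-cong (suc N) e = cong₂ _+_ (sumBelow-cong N (λ z z<N → e z (m<n⇒m<1+n z<N))) (e N ≤-refl)

sumBelow-point≤ : ∀ N h t → t < N → h t ≤ sumBelow N h
sumBelow-point≤ (suc N) h t t<1+N with m≤n⇒m<n∨m≡n (s≤s⁻¹ t<1+N)
... | inj₁ t<N  = ≤-trans (sumBelow-point≤ N h t t<N) (m≤m+n (sumBelow N h) (h N))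
... | inj₂ refl = m≤n+m (h t) (sumBelow t h)


sumBelow-exchange₁ : ∀ N h h′ a → (∀ z → z ≢ a → h z ≡ h′ z) → a < N →
  sumBelow N h + h′ a ≡ sumBelow N h′ + h a
sumBelow-exchange₁ (suc N) h h′ a agree a<1+N with N ≟ a
... | yes refl rewrite sumBelow-cong N {h} {h′} (λ z z<N → agree z (<⇒≢ z<N)) =
  xy∙z≈xz∙y (sumBelow N h′) (h N) (h′ N)
... | no N≢a with m≤n⇒m<n∨m≡n (s≤s⁻¹ a<1+N)
...   | inj₂ a≡N = ⊥-elim (N≢a (sym a≡N))
...   | inj₁ a<N rewrite agree N N≢a = begin
  sumBelow N h + h′ N + h′ a ≡⟨ xy∙z≈xz∙y (sumBelow N h) (h′ N) (h′ a) ⟩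
  sumBelow N h + h′ a + h′ N ≡⟨ cong (_+ h′ N) (sumBelow-exchange₁ N h h′ a agree a<N) ⟩
  sumBelow N h′ + h a + h′ N ≡⟨ xy∙z≈xz∙y (sumBelow N h′) (h a) (h′ N) ⟩
  sumBelow N h′ + h′ N + h a ∎
  where open ≡-Reasoning

sumBelow-exchange₂ : ∀ N h h′ a b → a ≢ b → a < N → b < N → (∀ z → z ≢ a → z ≢ b → h z ≡ h′ z) →
  sumBelow N h + (h′ a + h′ b) ≡ sumBelow N h′ + (h a + h b)
sumBelow-exchange₂ N h h′ a b a≢b a<N b<N agree = begin
  sumBelow N h + (h′ a + h′ b) ≡⟨ sym (+-assoc (sumBelow N h) (h′ a) (h′ b)) ⟩
  sumBelow N h + h′ a + h′ b   ≡⟨ cong (_+ h′ b) (trans (cong (sumBelow N h +_) (sym h-mid-a))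
                                    (sumBelow-exchange₁ N h h-mid a (λ z z≢a → sym (h-mid-off z z≢a)) a<N)) ⟩
  sumBelow N h-mid + h a + h′ b ≡⟨ xy∙z≈xz∙y (sumBelow N h-mid) (h a) (h′ b) ⟩
  sumBelow N h-mid + h′ b + h a ≡⟨ cong (_+ h a) (sumBelow-exchange₁ N h-mid h′ b mid-agree b<N) ⟩
  sumBelow N h′ + h-mid b + h a ≡⟨ cong (λ w → sumBelow N h′ + w + h a) h-mid-b ⟩
  sumBelow N h′ + h b + h a     ≡⟨ xy∙z≈x∙zy (sumBelow N h′) (h b) (h a) ⟩
  sumBelow N h′ + (h a + h b)   ∎
  where
  open ≡-Reasoning
  h-mid : ℕ → ℕ
  h-mid z = if z ≡ᵇ a then h′ a else h z
  h-mid-a : h-mid a ≡ h′ a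
  h-mid-a rewrite ≡ᵇ-refl a = refl
  h-mid-b : h-mid b ≡ h b
  h-mid-b rewrite ≢⇒≡ᵇ-false (λ b≡a → a≢b (sym b≡a)) = refl
  h-mid-off : ∀ z → z ≢ a → h-mid z ≡ h z
  h-mid-off z z≢a rewrite ≢⇒≡ᵇ-false z≢a = refl
  mid-agree : ∀ z → z ≢ b → h-mid z ≡ h′ z
  mid-agree z z≢b with z ≟ a
  ... | yes refl = h-mid-a
  ... | no z≢a   = trans (h-mid-off z z≢a) (agree z z≢a z≢b)

sumBelow-exchange-< : ∀ N h h′ a b → a ≢ b → a < N → b < N → (∀ z → z ≢ a → z ≢ b → h z ≡ h′ z) →
  h′ a + h′ b < h a + h b → sumBelow N h′ < sumBelow N h
sumBelow-exchange-< N h h′ a b a≢b a<N b<N agree lt =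
  +-cancelʳ-< (h a + h b) (sumBelow N h′) (sumBelow N h)
    (subst (_< sumBelow N h + (h a + h b)) (sumBelow-exchange₂ N h h′ a b a≢b a<N b<N agree)
           (+-monoʳ-< (sumBelow N h) lt))

sumBelow-≤-extend : ∀ N k h → sumBelow N h ≤ sumBelow (N + k) h
sumBelow-≤-extend N zero    h rewrite +-identityʳ N = ≤-refl
sumBelow-≤-extend N (suc k) h rewrite +-suc N k =
  ≤-trans (sumBelow-≤-extend N k h) (m≤m+n (sumBelow (N + k) h) (h (N + k)))

sumBelow-≥-ones : ∀ x h → (∀ y → 2 ≤ y → y ≤ x → h y ≡ 1) → x ∸ 1 ≤ sumBelow (suc x) h
sumBelow-≥-ones zero          h ones = z≤n
sumBelow-≥-ones (suc zero)    h ones = z≤n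
sumBelow-≥-ones (suc (suc x)) h ones =
  subst (λ w → suc x ≤ sumBelow (suc (suc x)) h + w) (sym (ones (suc (suc x)) (s≤s (s≤s z≤n)) ≤-refl))
    (subst (_≤ sumBelow (suc (suc x)) h + 1) (+-comm x 1)
      (+-monoˡ-≤ 1 (sumBelow-≥-ones (suc x) h (λ y 2≤y y≤x → ones y 2≤y (m≤n⇒m≤1+n y≤x)))))

sumBelow-≤-bits : ∀ N h → h 0 ≡ 0 → h 1 ≡ 0 → (∀ y → h y ≤ 1) → sumBelow N h ≤ N ∸ 2
sumBelow-≤-bits zero                h h0 h1 bit = z≤n
sumBelow-≤-bits (suc zero)          h h0 h1 bit rewrite h0 = z≤n
sumBelow-≤-bits (suc (suc zero))    h h0 h1 bit rewrite h0 | h1 = z≤n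
sumBelow-≤-bits (suc (suc (suc N))) h h0 h1 bit =
  subst (sumBelow (suc (suc N)) h + h (suc (suc N)) ≤_) (+-comm N 1)
    (+-mono-≤ (sumBelow-≤-bits (suc (suc N)) h h0 h1 bit) (bit (suc (suc N))))

sumBelow-vanishing : ∀ x h → (∀ y → x ≤ y → h y ≡ 0) → ∀ k → sumBelow (x + k) h ≡ sumBelow x h
sumBelow-vanishing x h zero-from zero    rewrite +-identityʳ x = refl
sumBelow-vanishing x h zero-from (suc k) rewrite +-suc x k | zero-from (x + k) (m≤m+n x k) =
  trans (+-identityʳ _) (sumBelow-vanishing x h zero-from k)

sumBelow-≤-support : ∀ x h → h 0 ≡ 0 → h 1 ≡ 0 → (∀ y → h y ≤ 1) → (∀ y → x ≤ y → h y ≡ 0) →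
  ∀ N → sumBelow N h ≤ x ∸ 2
sumBelow-≤-support x h h0 h1 bit zero-from N with ≤-total N x
... | inj₁ N≤x = ≤-trans (sumBelow-≤-bits N h h0 h1 bit) (∸-monoˡ-≤ 2 N≤x)
... | inj₂ x≤N = subst (_≤ x ∸ 2)
  (sym (trans (cong (λ w → sumBelow w h) (sym (m+[n∸m]≡n x≤N))) (sumBelow-vanishing x h zero-from (N ∸ x))))
  (sumBelow-≤-bits x h h0 h1 bit)

module _ {P : ℕ → Set} (P? : ∀ x → Dec (P x)) where

  least-below : ∀ N → (∀ x → x < N → ¬ P x) ⊎ Σ ℕ λ x → x < N × P x × (∀ y → y < x → ¬ P y)
  least-below zero = inj₁ (λ x ())
  least-below (suc N) with least-below N
  ... | inj₂ (x , x<N , px , below) = inj₂ (x , m<n⇒m<1+n x<N , px , below)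
  ... | inj₁ none with P? N
  ...   | yes pN = inj₂ (N , ≤-refl , pN , none)
  ...   | no ¬pN = inj₁ none′
    where
    none′ : ∀ x → x < suc N → ¬ P x
    none′ x x<1+N with m≤n⇒m<n∨m≡n (s≤s⁻¹ x<1+N)
    ... | inj₁ x<N  = none x x<N
    ... | inj₂ refl = ¬pN

  exists-below? : ∀ N → Dec (Σ ℕ λ x → x < N × P x)
  exists-below? N with least-below N
  ... | inj₁ none              = no (λ (x , x<N , px) → none x x<N px)
  ... | inj₂ (x , x<N , px , _) = yes (x , x<N , px)

-- Undoing a relabelling by shifts

record Perm (lo hi : ℕ) : Set where
  field
    to from : ℕ → ℕ
    to∘from : ∀ x → to (from x) ≡ x
    from∘to : ∀ x → from (to x) ≡ x
    to-in   : ∀ x → In lo hi x → In lo hi (to x)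
    from-in : ∀ x → In lo hi x → In lo hi (from x)

  to-injective : ∀ {a b} → to a ≡ to b → a ≡ b
  to-injective {a} {b} e = trans (sym (from∘to a)) (trans (cong from e) (from∘to b))

τ-in : ∀ {lo hi i j x} → In lo hi i → In lo hi j → In lo hi x → In lo hi (τ i j x)
τ-in {lo} {hi} {i} {j} {x} i∈ j∈ x∈ with place i j x
... | at-i      = j∈
... | at-j      = i∈
... | elsewhere = x∈

τ-after : ∀ {lo hi} (π : Perm lo hi) i j → i ≢ j → In lo hi i → In lo hi j → Perm lo hi
τ-after π i j i≢j i∈ j∈ = record
  { to      = λ x → τ i j (P.to x)
  ; from    = λ x → P.from (τ i j x)
  ; to∘from = λ x → trans (cong (τ i j) (P.to∘from (τ i j x))) (τ-involutive i≢j x)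
  ; from∘to = λ x → trans (cong P.from (τ-involutive i≢j (P.to x))) (P.from∘to x)
  ; to-in   = λ x x∈ → τ-in i∈ j∈ (P.to-in x x∈)
  ; from-in = λ x x∈ → P.from-in (τ i j x) (τ-in i∈ j∈ x∈)
  }
  where module P = Perm π

_² : ℕ → ℕ
n ² = n * n

displacement : ∀ {lo hi} → Perm lo hi → ℕ
displacement {hi = hi} π = sumBelow (suc hi) (λ z → ∣ z - Perm.to π z ∣ ²)

²-mono-< : ∀ {a b} → a < b → a ² < b ²
²-mono-< a<b = *-mono-< a<b a<b

-- The cost of the points x and y = π⁻¹ x before and after composing π with the
-- transposition of x and j = π x.
displacement-gain : ∀ x j y → x < j → x < y → ∣ y - j ∣ ² < ∣ x - j ∣ ² + ∣ y - x ∣ ²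
displacement-gain x j y x<j x<y
  rewrite m≤n⇒∣m-n∣≡n∸m (<⇒≤ x<j) | m≤n⇒∣n-m∣≡n∸m (<⇒≤ x<y) with ≤-total y j
... | inj₁ y≤j rewrite m≤n⇒∣m-n∣≡n∸m y≤j =
  <-≤-trans (²-mono-< (∸-monoʳ-< x<y y≤j)) (m≤m+n ((j ∸ x) ²) ((y ∸ x) ²))
... | inj₂ j≤y rewrite m≤n⇒∣n-m∣≡n∸m j≤y =
  <-≤-trans (²-mono-< (∸-monoʳ-< x<j j≤y)) (m≤n+m ((y ∸ x) ²) ((j ∸ x) ²))

module Untangle {lo hi : ℕ} {k : Adj} (k-shifted : ShiftedOn lo hi k) (k-supported : SupportedOn lo hi k)
                (k-irr : Irreflexive k) (k-sym : Symmetric k) where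

  record Untangling (π : Perm lo hi) (M : Adj) : Set where
    field
      i j         : ℕ
      valid       : i < j × In lo hi i × In lo hi j
      π′          : Perm lo hi
      decreases   : displacement π′ < displacement π
      shift-is-τ  : shift i j M ≗₂ M ∘₂ τ i j
      relabelled  : k ≗₂ (M ∘₂ τ i j) ∘₂ Perm.to π′

  relabel-by-identity : ∀ (π : Perm lo hi) M → k ≗₂ M ∘₂ Perm.to π →
    (∀ x → In lo hi x → Perm.to π x ≡ x) → M ≗₂ k
  relabel-by-identity π M k≗ fixed x y = ≡true-ext to-k from-k
    where
    open Perm π
    M≗ = unrelabel to to∘from M k≗
    to-k : M x y ≡ true → k x y ≡ true
    to-k h with k-supported (from x) (from y) (trans (sym (M≗ x y)) h)
    ... | fx∈ , fy∈ = subst₂ (λ a b → k a b ≡ true)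
      (trans (sym (fixed (from x) fx∈)) (to∘from x)) (trans (sym (fixed (from y) fy∈)) (to∘from y))
      (trans (sym (M≗ x y)) h)
    from-k : k x y ≡ true → M x y ≡ true
    from-k h with k-supported x y h
    ... | x∈ , y∈ = trans (cong₂ M (sym (fixed x x∈)) (sym (fixed y y∈))) (trans (sym (k≗ x y)) h)

  -- The least point x₀ moved by π is sent to j = π x₀ > x₀ and is hit by y₀ = π⁻¹ x₀ > x₀.
  -- Since k is shifted, the shift Shift_{x₀ j} of M only swaps x₀ and j, and composing π
  -- with that swap fixes x₀, which decreases the displacement.
  untangle-least-moved : ∀ (π : Perm lo hi) M → k ≗₂ M ∘₂ Perm.to π → ∀ x₀ → In lo hi x₀ →
    Perm.to π x₀ ≢ x₀ → (∀ y → lo ≤ y → y < x₀ → Perm.to π y ≡ y) → Untangling π M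
  untangle-least-moved π M k≗ x₀ x₀∈ moved below = record
    { i = x₀ ; j = j ; valid = x₀<j , x₀∈ , j∈ ; π′ = π′
    ; decreases = decreases ; shift-is-τ = shift-is-τ ; relabelled = relabelled }
    where
    open Perm π
    j = to x₀
    j∈ = to-in x₀ x₀∈
    y₀ = from x₀
    y₀∈ = from-in x₀ x₀∈
    x₀<j : x₀ < j
    x₀<j with <-cmp j x₀
    ... | tri< j<x₀ _ _ = ⊥-elim (moved (to-injective (below j (proj₁ j∈) j<x₀)))
    ... | tri≈ _ j≡x₀ _ = ⊥-elim (moved j≡x₀)
    ... | tri> _ _ x₀<j = x₀<j
    x₀<y₀ : x₀ < y₀
    x₀<y₀ with <-cmp y₀ x₀
    ... | tri< y₀<x₀ _ _ = ⊥-elim (<-irrefl (trans (sym (below y₀ (proj₁ y₀∈) y₀<x₀)) (to∘from x₀)) y₀<x₀)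
    ... | tri≈ _ y₀≡x₀ _ = ⊥-elim (moved (trans (cong to (sym y₀≡x₀)) (to∘from x₀)))
    ... | tri> _ _ x₀<y₀ = x₀<y₀
    x₀≢j = <⇒≢ x₀<j
    M≗ = unrelabel to to∘from M k≗
    shift-is-τ : shift x₀ j M ≗₂ M ∘₂ τ x₀ j
    shift-is-τ = shift-acts-as-τ x₀ j x₀≢j M (unrelabel-sym to to∘from M k≗ k-sym)
                   (unrelabel-irreflexive to to∘from M k≗ k-irr) x₀⊆j
      where
      x₀⊆j : ∀ t → t ≢ x₀ → t ≢ j → M x₀ t ≡ true → M j t ≡ true
      x₀⊆j t _ t≢j h = trans (cong (M j) (sym (to∘from t))) (trans (sym (k≗ x₀ (from t))) k-x₀)
        where
        k-y₀ : k y₀ (from t) ≡ true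
        k-y₀ = trans (sym (M≗ x₀ t)) h
        k-x₀ : k x₀ (from t) ≡ true
        k-x₀ = k-shifted y₀ (from t) x₀ (from t) k-y₀ x₀∈ (proj₂ (k-supported y₀ (from t) k-y₀))
                 (<⇒≤ x₀<y₀) ≤-refl (λ x₀≡ → t≢j (trans (sym (to∘from t)) (cong to (sym x₀≡))))
    π′ = τ-after π x₀ j x₀≢j x₀∈ j∈
    relabelled : k ≗₂ (M ∘₂ τ x₀ j) ∘₂ Perm.to π′
    relabelled x y = trans (k≗ x y) (sym (cong₂ M (τ-involutive x₀≢j (to x)) (τ-involutive x₀≢j (to y))))
    cost cost′ : ℕ → ℕ
    cost  z = ∣ z - to z ∣ ²
    cost′ z = ∣ z - τ x₀ j (to z) ∣ ²
    same-cost : ∀ z → z ≢ x₀ → z ≢ y₀ → cost z ≡ cost′ z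
    same-cost z z≢x₀ z≢y₀ = cong (λ w → ∣ z - w ∣ ²)
      (sym (τ-elsewhere {x₀} {j} {to z}
              (place-elsewhere (λ e → z≢y₀ (trans (sym (from∘to z)) (cong from e)))
                               (λ e → z≢x₀ (to-injective e)))))
    cost′-x₀ : cost′ x₀ ≡ 0
    cost′-x₀ rewrite τ-j x₀≢j | ∣n-n∣≡0 x₀ = refl
    cost′-y₀ : cost′ y₀ ≡ ∣ y₀ - j ∣ ²
    cost′-y₀ rewrite to∘from x₀ | τ-i x₀ j = refl
    decreases : displacement π′ < displacement π
    decreases = sumBelow-exchange-< (suc hi) cost cost′ x₀ y₀ (<⇒≢ x₀<y₀) (s≤s (proj₂ x₀∈)) (s≤s (proj₂ y₀∈))
      same-cost (subst (_< cost x₀ + cost y₀) (sym (cong₂ _+_ cost′-x₀ cost′-y₀))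
        (subst (λ w → ∣ y₀ - j ∣ ² < ∣ x₀ - j ∣ ² + ∣ y₀ - w ∣ ²) (sym (to∘from x₀))
          (displacement-gain x₀ j y₀ x₀<j x₀<y₀)))

  untangle-step : ∀ (π : Perm lo hi) M → k ≗₂ M ∘₂ Perm.to π → (M ≗₂ k) ⊎ Untangling π M
  untangle-step π M k≗ with least-below (λ x → (lo ≤? x) ×-dec ¬? (Perm.to π x ≟ x)) (suc hi)
  ... | inj₁ none = inj₁ (relabel-by-identity π M k≗ fixed)
    where
    fixed : ∀ x → In lo hi x → Perm.to π x ≡ x
    fixed x (lo≤x , x≤hi) = decidable-stable (Perm.to π x ≟ x) (λ moved → none x (s≤s x≤hi) (lo≤x , moved))
  ... | inj₂ (x₀ , x₀<1+hi , (lo≤x₀ , moved) , least) =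
    inj₂ (untangle-least-moved π M k≗ x₀ (lo≤x₀ , s≤s⁻¹ x₀<1+hi) moved fixed-below)
    where
    fixed-below : ∀ y → lo ≤ y → y < x₀ → Perm.to π y ≡ y
    fixed-below y lo≤y y<x₀ = decidable-stable (Perm.to π y ≟ y) (λ moved′ → least y y<x₀ (lo≤y , moved′))

  untangle : ∀ bound (π : Perm lo hi) M → k ≗₂ M ∘₂ Perm.to π → displacement π ≤ bound →
    Σ (List (ℕ × ℕ)) λ qs → ValidShifts lo hi qs × shifts qs M ≗₂ k
  untangle bound π M k≗ bd with untangle-step π M k≗
  ... | inj₁ M≗k = [] , [] , M≗k
  ... | inj₂ u with bound
  ...   | zero = ⊥-elim (n≮0 (<-≤-trans (Untangling.decreases u) bd))
  ...   | suc b with untangle b (Untangling.π′ u) _ (Untangling.relabelled u)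
                      (s≤s⁻¹ (<-≤-trans (Untangling.decreases u) bd))
  ...     | qs , vqs , eq = (Untangling.i u , Untangling.j u) ∷ qs , Untangling.valid u ∷ vqs ,
                            ≗₂-trans (shifts-cong qs (Untangling.shift-is-τ u)) eq

-- A shift of a relabelled adjacency is a relabelled shift: Shift_{ab}(M ∘ π) is
-- Shift_{π a, π b}(M) ∘ π, and if π a > π b the two endpoints are put in order at the
-- cost of composing π with their transposition.
shift-relabel-step : ∀ {lo hi} a b r (π : Perm lo hi) M → a < b → In lo hi a → In lo hi b →
  Symmetric r → Irreflexive r → r ≗₂ M ∘₂ Perm.to π →
  Σ (ℕ × ℕ) λ (a′ , b′) → (a′ < b′ × In lo hi a′ × In lo hi b′) ×
    Σ (Perm lo hi) λ π′ → shift a b r ≗₂ shift a′ b′ M ∘₂ Perm.to π′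
shift-relabel-step {lo} {hi} a b r π M a<b a∈ b∈ r-sym r-irr r≗ = by-order (<-cmp (to a) (to b))
  where
  open Perm π
  shift≗ : shift a b r ≗₂ shift (to a) (to b) M ∘₂ to
  shift≗ = ≗₂-trans (shift-cong a b r≗) (shift-relabel to {from} from∘to a b M)
  by-order : Tri (to a < to b) (to a ≡ to b) (to b < to a) →
    Σ (ℕ × ℕ) λ (a′ , b′) → (a′ < b′ × In lo hi a′ × In lo hi b′) ×
      Σ (Perm lo hi) λ π′ → shift a b r ≗₂ shift a′ b′ M ∘₂ Perm.to π′
  by-order (tri< lt _ _) = (to a , to b) , (lt , to-in a a∈ , to-in b b∈) , π , shift≗
  by-order (tri≈ _ eq _) = ⊥-elim (<⇒≢ a<b (to-injective eq))
  by-order (tri> _ _ gt) =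
    (to b , to a) , (gt , to-in b b∈ , to-in a a∈) , τ-after π (to b) (to a) (<⇒≢ gt) (to-in b b∈) (to-in a a∈) ,
    ≗₂-trans shift≗ (λ x y → shift-flip (to b) (to a) (<⇒≢ gt) M
      (unrelabel-sym to to∘from M r≗ r-sym) (unrelabel-irreflexive to to∘from M r≗ r-irr) (to x) (to y))

shifts-relabel : ∀ {lo hi} ps r (π : Perm lo hi) M → ValidShifts lo hi ps →
  Symmetric r → Irreflexive r → r ≗₂ M ∘₂ Perm.to π →
  ShiftedOn lo hi (shifts ps r) → SupportedOn lo hi (shifts ps r) →
  Σ (List (ℕ × ℕ)) λ qs → ValidShifts lo hi qs × shifts qs M ≗₂ shifts ps r
shifts-relabel [] r π M _ r-sym r-irr r≗ shifted supported =
  Untangle.untangle shifted supported r-irr r-sym (displacement π) π M r≗ ≤-refl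
shifts-relabel ((a , b) ∷ ps) r π M ((a<b , a∈ , b∈) ∷ vps) r-sym r-irr r≗ shifted supported
  with shift-relabel-step a b r π M a<b a∈ b∈ r-sym r-irr r≗
... | (a′ , b′) , valid , π′ , r₁≗
  with shifts-relabel ps (shift a b r) π′ (shift a′ b′ M) vps (shift-sym a b r r-sym)
         (shift-irreflexive a b r r-irr) r₁≗ shifted supported
...   | qs , vqs , eq = (a′ , b′) ∷ qs , valid ∷ vqs , eq

-- Cones with apex 1

cone : (ℕ → Bool) → Adj → Adj
cone s m x y = if x ≡ᵇ 1 then s y else (if y ≡ᵇ 1 then s x else m x y)

cone-to-1 : ∀ s m x → x ≢ 1 → cone s m x 1 ≡ s x
cone-to-1 s m x x≢1 rewrite ≢⇒≡ᵇ-false x≢1 = refl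

cone-away : ∀ s m x y → x ≢ 1 → y ≢ 1 → cone s m x y ≡ m x y
cone-away s m x y x≢1 y≢1 rewrite ≢⇒≡ᵇ-false x≢1 | ≢⇒≡ᵇ-false y≢1 = refl

cone-cong : ∀ {s s′ m m′} → (∀ x → s x ≡ s′ x) → m ≗₂ m′ → cone s m ≗₂ cone s′ m′
cone-cong hs hm x y with x ≡ᵇ 1 | y ≡ᵇ 1
... | true  | _     = hs y
... | false | true  = hs x
... | false | false = hm x y

shiftSetAt : ℕ → ℕ → (ℕ → Bool) → ℕ → Place → Bool
shiftSetAt a b s x at-i      = s a ∨ s b
shiftSetAt a b s x at-j      = s b ∧ s a
shiftSetAt a b s x elsewhere = s x

shiftSet : ℕ → ℕ → (ℕ → Bool) → ℕ → Bool
shiftSet a b s x = shiftSetAt a b s x (place a b x)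

record IsCone (n : ℕ) (s : ℕ → Bool) (m : Adj) : Set where
  field
    1∉link         : s 1 ≡ false
    link⊆          : ∀ x → s x ≡ true → In 2 n x
    base-supported : SupportedOn 2 n m
    base-sym       : Symmetric m
    base-irr       : Irreflexive m
    base⊆link      : ∀ x y → m x y ≡ true → s x ≡ true

IsCone-cong : ∀ {n s m m′} → m ≗₂ m′ → IsCone n s m → IsCone n s m′
IsCone-cong e c = record
  { 1∉link         = 1∉link
  ; link⊆          = link⊆
  ; base-supported = λ x y h → base-supported x y (trans (e x y) h)
  ; base-sym       = λ x y → trans (sym (e x y)) (trans (base-sym x y) (e y x))
  ; base-irr       = λ x → trans (sym (e x x)) (base-irr x)
  ; base⊆link      = λ x y h → base⊆link x y (trans (e x y) h)
  }
  where open IsCone c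

cone-sym : ∀ {n s m} → IsCone n s m → Symmetric (cone s m)
cone-sym {s = s} {m} c x y with x ≟ 1 | y ≟ 1
... | yes refl | yes refl = refl
... | yes refl | no y≢1   = sym (cone-to-1 s m y y≢1)
... | no x≢1   | yes refl = cone-to-1 s m x x≢1
... | no x≢1   | no y≢1   =
  trans (cone-away s m x y x≢1 y≢1) (trans (IsCone.base-sym c x y) (sym (cone-away s m y x y≢1 x≢1)))

cone-irreflexive : ∀ {n s m} → IsCone n s m → Irreflexive (cone s m)
cone-irreflexive {s = s} {m} c x with x ≟ 1
... | yes refl = IsCone.1∉link c
... | no x≢1   = trans (cone-away s m x x x≢1 x≢1) (IsCone.base-irr c x)

-- In a cone every neighbour of b is a neighbour of 1, so Shift_{1b} changes nothing.
shift-1-cone : ∀ {n s m} b → b ≢ 1 → IsCone n s m → shift 1 b (cone s m) ≗₂ cone s m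
shift-1-cone {s = s} {m} b b≢1 c =
  shift-trivial 1 b (λ 1≡b → b≢1 (sym 1≡b)) (cone s m) (cone-sym c) (cone-irreflexive c) b⊆1
  where
  b⊆1 : ∀ t → t ≢ 1 → t ≢ b → cone s m b t ≡ true → cone s m 1 t ≡ true
  b⊆1 t t≢1 _ h = IsCone.base⊆link c t b
    (trans (IsCone.base-sym c t b) (trans (sym (cone-away s m b t b≢1 t≢1)) h))

module _ (a b : ℕ) (a≢1 : a ≢ 1) (b≢1 : b ≢ 1) (a≢b : a ≢ b) (s : ℕ → Bool) (m : Adj) where
  private
    1≢a : 1 ≢ a
    1≢a 1≡a = a≢1 (sym 1≡a)
    1≢b : 1 ≢ b
    1≢b 1≡b = b≢1 (sym 1≡b)
    away = cone-away s m
    place-1 : place a b 1 ≡ elsewhere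
    place-1 = place-elsewhere {a} {b} {1} 1≢a 1≢b

  shift-cone : shift a b (cone s m) ≗₂ cone (shiftSet a b s) (shift a b m)
  shift-cone x y with x ≟ 1 | y ≟ 1
  ... | yes refl | _ rewrite place-1 with place a b y
  ...   | at-i      = refl
  ...   | at-j      = refl
  ...   | elsewhere = refl
  shift-cone x y | no x≢1 | yes refl =
    trans (to-1 x x≢1) (sym (cone-to-1 (shiftSet a b s) (shift a b m) x x≢1))
    where
    to-1 : ∀ x → x ≢ 1 → shift a b (cone s m) x 1 ≡ shiftSet a b s x
    to-1 x x≢1 rewrite place-1 with place a b x
    ... | at-i      = cong₂ _∨_ (cone-to-1 s m a a≢1) (cone-to-1 s m b b≢1)
    ... | at-j      = cong₂ _∧_ (cone-to-1 s m b b≢1) (cone-to-1 s m a a≢1)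
    ... | elsewhere = cone-to-1 s m x x≢1
  shift-cone x y | no x≢1 | no y≢1
    rewrite cone-away (shiftSet a b s) (shift a b m) x y x≢1 y≢1 with place a b x | place a b y
  ... | at-i      | at-i      = refl
  ... | at-i      | at-j      = away a b a≢1 b≢1
  ... | at-i      | elsewhere = cong₂ _∨_ (away a y a≢1 y≢1) (away b y b≢1 y≢1)
  ... | at-j      | at-i      = away b a b≢1 a≢1
  ... | at-j      | at-j      = refl
  ... | at-j      | elsewhere = cong₂ _∧_ (away b y b≢1 y≢1) (away a y a≢1 y≢1)
  ... | elsewhere | at-i      = cong₂ _∨_ (away x a x≢1 a≢1) (away x b x≢1 b≢1)
  ... | elsewhere | at-j      = cong₂ _∧_ (away x b x≢1 b≢1) (away x a x≢1 a≢1)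
  ... | elsewhere | elsewhere = away x y x≢1 y≢1

  IsCone-shift : ∀ {n} → In 2 n a → In 2 n b → IsCone n s m → IsCone n (shiftSet a b s) (shift a b m)
  IsCone-shift {n} a∈ b∈ c = record
    { 1∉link         = subst (λ p → shiftSetAt a b s 1 p ≡ false) (sym place-1) 1∉link
    ; link⊆          = link⊆′
    ; base-supported = shift-supported a∈ b∈ base-supported
    ; base-sym       = shift-sym a b m base-sym
    ; base-irr       = shift-irreflexive a b m base-irr
    ; base⊆link      = base⊆link′
    }
    where
    open IsCone c
    link⊆′ : ∀ x → shiftSet a b s x ≡ true → In 2 n x
    link⊆′ x h with place a b x in p
    ... | at-i      = at-i-subst (In 2 n) p a∈
    ... | at-j      = at-j-subst (In 2 n) p b∈
    ... | elsewhere = link⊆ x h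
    base⊆link′ : ∀ x y → shift a b m x y ≡ true → shiftSet a b s x ≡ true
    base⊆link′ x y h with place a b x | place a b y
    ... | at-i      | at-i      = ⊥-elim (true≢false (sym h))
    ... | at-j      | at-j      = ⊥-elim (true≢false (sym h))
    ... | at-i      | at-j      = ∨-introˡ (base⊆link a b h)
    ... | at-i      | elsewhere =
      either (λ q → ∨-introˡ (base⊆link a y q)) (λ q → ∨-introʳ (base⊆link b y q)) (∨-elim {m a y} h)
    ... | at-j      | at-i      = ∧-intro (base⊆link b a h) (base⊆link a b (trans (base-sym a b) h))
    ... | at-j      | elsewhere = let (hb , ha) = ∧-elim {m b y} h in
                                  ∧-intro (base⊆link b y hb) (base⊆link a y ha)
    ... | elsewhere | at-i      = either (base⊆link x a) (base⊆link x b) (∨-elim {m x a} h)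
    ... | elsewhere | at-j      = base⊆link x b (proj₁ (∧-elim {m x b} h))
    ... | elsewhere | elsewhere = base⊆link x y h

bit : Bool → ℕ
bit true  = 1
bit false = 0

bit≤1 : ∀ b → bit b ≤ 1
bit≤1 true  = ≤-refl
bit≤1 false = z≤n

bit-∨-∧ : ∀ x y → bit (x ∨ y) + bit (y ∧ x) ≡ bit x + bit y
bit-∨-∧ true  true  = refl
bit-∨-∧ true  false = refl
bit-∨-∧ false true  = refl
bit-∨-∧ false false = refl

count : ℕ → (ℕ → Bool) → ℕ
count n s = sumBelow (suc n) (λ x → bit (s x))

count-cong : ∀ n {s s′} → (∀ x → s x ≡ s′ x) → count n s ≡ count n s′
count-cong n e = sumBelow-cong (suc n) (λ z _ → cong bit (e z))

shiftSet-count : ∀ n a b s → a ≢ b → a < suc n → b < suc n → count n (shiftSet a b s) ≡ count n s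
shiftSet-count n a b s a≢b a<1+n b<1+n =
  sym (+-cancelʳ-≡ (bit (s a) + bit (s b)) (sumBelow (suc n) old) (sumBelow (suc n) new)
    (trans (cong (sumBelow (suc n) old +_) (sym at-a-b))
           (sumBelow-exchange₂ (suc n) old new a b a≢b a<1+n b<1+n agree)))
  where
  old new : ℕ → ℕ
  old x = bit (s x)
  new x = bit (shiftSet a b s x)
  at-a-b : new a + new b ≡ old a + old b
  at-a-b rewrite place-i a b | place-j a≢b = bit-∨-∧ (s a) (s b)
  agree : ∀ z → z ≢ a → z ≢ b → old z ≡ new z
  agree z z≢a z≢b rewrite place-elsewhere {a} {b} {z} z≢a z≢b = refl

record ConeOver (n d : ℕ) (m r : Adj) : Set where
  field
    link   : ℕ → Bool
    isCone : IsCone n link m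
    size   : count n link ≡ d
    form   : r ≗₂ cone link m

ConeOver-cong : ∀ {n d m m′ r r′} → m ≗₂ m′ → r ≗₂ r′ → ConeOver n d m r → ConeOver n d m′ r′
ConeOver-cong em er c = record
  { link   = link
  ; isCone = IsCone-cong em isCone
  ; size   = size
  ; form   = ≗₂-trans (≗₂-sym er) (≗₂-trans form (cone-cong (λ _ → refl) em))
  }
  where open ConeOver c

ConeOver-shift : ∀ {n d m r a b} → In 2 n a → In 2 n b → a ≢ b → ConeOver n d m r →
  ConeOver n d (shift a b m) (shift a b r)
ConeOver-shift {n} {m = m} {a = a} {b} a∈ b∈ a≢b c = record
  { link   = shiftSet a b link
  ; isCone = IsCone-shift a b a≢1 b≢1 a≢b link m a∈ b∈ isCone
  ; size   = trans (shiftSet-count n a b link a≢b (s≤s (proj₂ a∈)) (s≤s (proj₂ b∈))) size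
  ; form   = ≗₂-trans (shift-cong a b form) (shift-cone a b a≢1 b≢1 a≢b link m)
  }
  where
  open ConeOver c
  a≢1 = ≥2⇒≢1 (proj₁ a∈)
  b≢1 = ≥2⇒≢1 (proj₁ b∈)

ConeOver-shifts-on-[2,n] : ∀ {n d m r} qs → ValidShifts 2 n qs → ConeOver n d m r →
  ConeOver n d (shifts qs m) (shifts qs r)
ConeOver-shifts-on-[2,n] []             _                        c = c
ConeOver-shifts-on-[2,n] ((a , b) ∷ qs) ((a<b , a∈ , b∈) ∷ vqs) c =
  ConeOver-shifts-on-[2,n] qs vqs (ConeOver-shift a∈ b∈ (<⇒≢ a<b) c)

ConeOver-shift-1 : ∀ {n d m r} b → b ≢ 1 → ConeOver n d m r → ConeOver n d m (shift 1 b r)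
ConeOver-shift-1 b b≢1 c = record
  { link = link ; isCone = isCone ; size = size
  ; form = ≗₂-trans (shift-cong 1 b form) (shift-1-cone b b≢1 isCone) }
  where open ConeOver c

-- Shifts through the apex 1 act trivially on a cone, and the others act on the base.
ConeOver-shifts-on-[1,n] : ∀ {n d m r} ps → ValidShifts 1 n ps → ConeOver n d m r →
  Σ (List (ℕ × ℕ)) λ qs → ValidShifts 2 n qs × ConeOver n d (shifts qs m) (shifts ps r)
ConeOver-shifts-on-[1,n] [] _ c = [] , [] , c
ConeOver-shifts-on-[1,n] ((a , b) ∷ ps) ((a<b , a∈ , b∈) ∷ vps) c with a ≟ 1
... | yes refl = ConeOver-shifts-on-[1,n] ps vps (ConeOver-shift-1 b (λ b≡1 → <⇒≢ a<b (sym b≡1)) c)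
... | no a≢1 =
  let (qs , vqs , c′) = ConeOver-shifts-on-[1,n] ps vps (ConeOver-shift a∈₂ b∈₂ (<⇒≢ a<b) c)
  in (a , b) ∷ qs , (a<b , a∈₂ , b∈₂) ∷ vqs , c′
  where
  a∈₂ = In1⇒In2 a∈ a≢1
  b∈₂ = In1⇒In2 b∈ (λ b≡1 → <⇒≢ (≤-<-trans (proj₁ a∈) a<b) (sym b≡1))

-- Compressing the link of the apex

DownClosed : (ℕ → Bool) → Set
DownClosed s = ∀ a b → 2 ≤ a → a < b → s b ≡ true → s a ≡ true

weight : ℕ → (ℕ → Bool) → ℕ
weight n s = sumBelow (suc n) (λ x → if s x then x else 0)

-- With a outside and b inside the link, Shift_{ab} fixes the shifted base and trades b for
-- the smaller a in the link.
compress-step : ∀ {n d m r} (c : ConeOver n d m r) → ShiftedOn 2 n m → ∀ a b → 2 ≤ a → a < b →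
  ConeOver.link c a ≡ false → ConeOver.link c b ≡ true → (a < b × In 2 n a × In 2 n b) ×
  Σ (ConeOver n d m (shift a b r)) λ c′ → weight n (ConeOver.link c′) < weight n (ConeOver.link c)
compress-step {n} {m = m} c m-shifted a b 2≤a a<b sa sb =
  (a<b , a∈ , b∈) , ConeOver-cong base-fixed ≗₂-refl (ConeOver-shift a∈ b∈ a≢b c) , lighter
  where
  open ConeOver c
  open IsCone isCone
  b∈ = link⊆ b sb
  a∈ : In 2 n a
  a∈ = 2≤a , ≤-trans (<⇒≤ a<b) (proj₂ b∈)
  a≢b = <⇒≢ a<b
  base-fixed : shift a b m ≗₂ m
  base-fixed = shift-trivial a b a≢b m base-sym base-irr b⊆a
    where
    b⊆a : ∀ t → t ≢ a → t ≢ b → m b t ≡ true → m a t ≡ true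
    b⊆a t t≢a _ h =
      m-shifted b t a t h a∈ (proj₂ (base-supported b t h)) (<⇒≤ a<b) ≤-refl (λ a≡t → t≢a (sym a≡t))
  old new : ℕ → ℕ
  old x = if link x then x else 0
  new x = if shiftSet a b link x then x else 0
  lighter : weight n (shiftSet a b link) < weight n link
  lighter = sumBelow-exchange-< (suc n) old new a b a≢b (s≤s (proj₂ a∈)) (s≤s (proj₂ b∈)) agree new<old
    where
    agree : ∀ z → z ≢ a → z ≢ b → old z ≡ new z
    agree z z≢a z≢b rewrite place-elsewhere {a} {b} {z} z≢a z≢b = refl
    new<old : new a + new b < old a + old b
    new<old rewrite place-i a b | place-j a≢b | sa | sb = subst (_< b) (sym (+-identityʳ a)) a<b

compress : ∀ {n d m r} bound (c : ConeOver n d m r) → ShiftedOn 2 n m → weight n (ConeOver.link c) ≤ bound →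
  Σ (List (ℕ × ℕ)) λ qs → ValidShifts 2 n qs ×
    Σ (ConeOver n d m (shifts qs r)) λ c′ → DownClosed (ConeOver.link c′)
compress {n} bound c m-shifted bd with least-below gap? (suc n)
  where
  open ConeOver c
  Gap : ℕ → Set
  Gap a = 2 ≤ a × link a ≡ false × Σ ℕ λ b → b < suc n × (a < b × link b ≡ true)
  gap? : ∀ a → Dec (Gap a)
  gap? a = (2 ≤? a) ×-dec (link a ≟ᴮ false) ×-dec
           exists-below? (λ b → (a <? b) ×-dec (link b ≟ᴮ true)) (suc n)
... | inj₁ no-gap = [] , [] , c , down-closed
  where
  open ConeOver c
  down-closed : DownClosed link
  down-closed a b 2≤a a<b sb with link a in sa
  ... | true  = refl
  ... | false = ⊥-elim (no-gap a (s≤s (≤-trans (<⇒≤ a<b) b≤n)) (2≤a , sa , b , s≤s b≤n , a<b , sb))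
    where b≤n = proj₂ (IsCone.link⊆ isCone b sb)
... | inj₂ (a , _ , (2≤a , sa , b , _ , a<b , sb) , _) with compress-step c m-shifted a b 2≤a a<b sa sb
...   | valid , c₁ , lighter with bound
...     | zero  = ⊥-elim (n≮0 (<-≤-trans lighter bd))
...     | suc b′ with compress b′ c₁ m-shifted (s≤s⁻¹ (<-≤-trans lighter bd))
...       | qs , vqs , c′ = (a , b) ∷ qs , valid ∷ vqs , c′

interval : ℕ → ℕ → Bool
interval d x = (2 ≤ᵇ x) ∧ (x ≤ᵇ suc d)

interval-sound : ∀ {d x} → interval d x ≡ true → 2 ≤ x × x ≤ suc d
interval-sound {d} {x} h = let (p , q) = ∧-elim {2 ≤ᵇ x} h in ≤ᵇ⇒≤′ p , ≤ᵇ⇒≤′ q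

interval-complete : ∀ {d x} → 2 ≤ x → x ≤ suc d → interval d x ≡ true
interval-complete 2≤x x≤1+d = ∧-intro (≤⇒≤ᵇ′ 2≤x) (≤⇒≤ᵇ′ x≤1+d)

module _ {n s m} (c : IsCone n s m) (down-closed : DownClosed s) where
  open IsCone c

  member-≤-count : ∀ x → s x ≡ true → x ≤ suc (count n s)
  member-≤-count x sx =
    ≤-trans (m≤n+m∸n x 1) (s≤s (≤-trans (sumBelow-≥-ones x (λ z → bit (s z)) ones) extend))
    where
    x≤n = proj₂ (link⊆ x sx)
    ones : ∀ y → 2 ≤ y → y ≤ x → bit (s y) ≡ 1
    ones y 2≤y y≤x with m≤n⇒m<n∨m≡n y≤x
    ... | inj₁ y<x  rewrite down-closed y x 2≤y y<x sx = refl
    ... | inj₂ refl rewrite sx = refl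
    extend : sumBelow (suc x) (λ z → bit (s z)) ≤ count n s
    extend = subst (λ w → sumBelow (suc x) (λ z → bit (s z)) ≤ sumBelow w (λ z → bit (s z)))
      (cong suc (m+[n∸m]≡n x≤n)) (sumBelow-≤-extend (suc x) (n ∸ x) (λ z → bit (s z)))

  count-≤-nonmember : ∀ x → 2 ≤ x → s x ≡ false → count n s ≤ x ∸ 2
  count-≤-nonmember x 2≤x sx =
    sumBelow-≤-support x (λ z → bit (s z)) (cong bit s0) (cong bit 1∉link) (λ y → bit≤1 (s y))
                       zero-from (suc n)
    where
    s0 : s 0 ≡ false
    s0 = ≢true⇒≡false (λ h → 1+n≰n {0} (≤-trans (s≤s z≤n) (proj₁ (link⊆ 0 h))))
    zero-from : ∀ y → x ≤ y → bit (s y) ≡ 0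
    zero-from y x≤y with s y in sy
    ... | false = refl
    ... | true with m≤n⇒m<n∨m≡n x≤y
    ...   | inj₁ x<y  = ⊥-elim (true≢false (trans (sym (down-closed x y 2≤x x<y sy)) sx))
    ...   | inj₂ refl = ⊥-elim (true≢false (trans (sym sy) sx))

  link-interval : ∀ x → s x ≡ interval (count n s) x
  link-interval x with s x in sx
  ... | true = sym (interval-complete (proj₁ (link⊆ x sx)) (member-≤-count x sx))
  ... | false with 2 ≤? x
  ...   | no  2≰x = sym (cong (_∧ (x ≤ᵇ suc (count n s))) (≰⇒≤ᵇ-false 2≰x))
  ...   | yes 2≤x = sym (trans (cong ((2 ≤ᵇ x) ∧_) (≰⇒≤ᵇ-false above)) (∧-zeroʳ (2 ≤ᵇ x)))
    where
    above : ¬ (x ≤ suc (count n s))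
    above x≤ = <-irrefl refl (≤-trans (s≤s x≤) (≤-trans (s≤s (s≤s (count-≤-nonmember x 2≤x sx)))
                 (≤-reflexive (trans (+-comm 2 (x ∸ 2)) (m∸n+n≡m 2≤x)))))

cone-edge-in-link : ∀ {n s m a b} → IsCone n s m → cone s m a b ≡ true → b ≢ 1 → s b ≡ true
cone-edge-in-link {s = s} {m} {a} {b} c h b≢1 with a ≟ 1
... | yes refl = h
... | no a≢1   =
  IsCone.base⊆link c b a (trans (IsCone.base-sym c b a) (trans (sym (cone-away s m a b a≢1 b≢1)) h))

module _ {n d m r} (c : ConeOver n d m r) where
  open ConeOver c
  open IsCone isCone

  ConeOver-interval : DownClosed link → ∀ x → link x ≡ interval d x
  ConeOver-interval dc x = trans (link-interval isCone dc x) (cong (λ w → interval w x) size)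

  ConeOver-link-downClosed : ShiftedOn 1 n r → DownClosed link
  ConeOver-link-downClosed r-shifted a b 2≤a a<b sb =
    trans (sym (form 1 a)) (r-shifted 1 b 1 a (trans (form 1 b) sb) (≤-refl , 1≤n) (In2⇒In1 a∈) ≤-refl
                                      (<⇒≤ a<b) (λ 1≡a → ≥2⇒≢1 2≤a (sym 1≡a)))
    where
    b≤n = proj₂ (link⊆ b sb)
    a∈ : In 2 n a
    a∈ = 2≤a , ≤-trans (<⇒≤ a<b) b≤n
    1≤n = ≤-trans (s≤s z≤n) (≤-trans (proj₁ (link⊆ b sb)) b≤n)

  ConeOver-base-shifted : ShiftedOn 1 n r → ShiftedOn 2 n m
  ConeOver-base-shifted r-shifted a b a′ b′ h a′∈ b′∈ a′≤a b′≤b a′≢b′ =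
    trans (sym (away a′ b′ a′∈ b′∈)) (trans (sym (form a′ b′))
      (r-shifted a b a′ b′ (trans (form a b) (trans (away a b a∈ b∈) h))
                 (In2⇒In1 a′∈) (In2⇒In1 b′∈) a′≤a b′≤b a′≢b′))
    where
    away : ∀ x y → In 2 n x → In 2 n y → cone link m x y ≡ m x y
    away x y x∈ y∈ = cone-away link m x y (≥2⇒≢1 (proj₁ x∈)) (≥2⇒≢1 (proj₁ y∈))
    a∈ = proj₁ (base-supported a b h)
    b∈ = proj₂ (base-supported a b h)

  ConeOver-shifted : (∀ x → link x ≡ interval d x) → ShiftedOn 2 n m → ShiftedOn 1 n r
  ConeOver-shifted link≡ m-shifted a b a′ b′ h a′∈ b′∈ a′≤a b′≤b a′≢b′ =
    trans (form a′ b′) (cone-shifted (trans (sym (form a b)) h))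
    where
    link-down : ∀ x y → link x ≡ true → 2 ≤ y → y ≤ x → link y ≡ true
    link-down x y sx 2≤y y≤x = trans (link≡ y)
      (interval-complete 2≤y (≤-trans y≤x (proj₂ (interval-sound (trans (sym (link≡ x)) sx)))))
    cone-shifted : cone link m a b ≡ true → cone link m a′ b′ ≡ true
    cone-shifted h with a′ ≟ 1 | b′ ≟ 1
    ... | yes refl | yes refl = ⊥-elim (a′≢b′ refl)
    ... | yes refl | no b′≢1  = link-down b b′ (cone-edge-in-link {a = a} isCone h b≢1) 2≤b′ b′≤b
      where
      2≤b′ = ≢1⇒≥2 (proj₁ b′∈) b′≢1
      b≢1 = ≥2⇒≢1 (≤-trans 2≤b′ b′≤b)
    ... | no a′≢1  | yes refl = trans (cone-to-1 link m a′ a′≢1)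
      (link-down a a′ (cone-edge-in-link {a = b} isCone (trans (cone-sym isCone b a) h) a≢1) 2≤a′ a′≤a)
      where
      2≤a′ = ≢1⇒≥2 (proj₁ a′∈) a′≢1
      a≢1 = ≥2⇒≢1 (≤-trans 2≤a′ a′≤a)
    ... | no a′≢1  | no b′≢1  = trans (cone-away link m a′ b′ a′≢1 b′≢1)
      (m-shifted a b a′ b′ (trans (sym (cone-away link m a b a≢1 b≢1)) h)
                 (In1⇒In2 a′∈ a′≢1) (In1⇒In2 b′∈ b′≢1) a′≤a b′≤b a′≢b′)
      where
      a≢1 = ≥2⇒≢1 (≤-trans (≢1⇒≥2 (proj₁ a′∈) a′≢1) a′≤a)
      b≢1 = ≥2⇒≢1 (≤-trans (≢1⇒≥2 (proj₁ b′∈) b′≢1) b′≤b)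

ConeOver-StarProp : ∀ {n d K K′} (c : ConeOver n d (adj K′) (adj K)) →
  (∀ x → ConeOver.link c x ≡ interval d x) → StarProp d K K′
ConeOver-StarProp {n} {d} {K} {K′} c link≡ a b = mk⇔ to from
  where
  open ConeOver c
  in-interval : ∀ x → link x ≡ true → 2 ≤ x × x ≤ suc d
  in-interval x h = interval-sound (trans (sym (link≡ x)) h)
  link-of : ∀ x → 2 ≤ x → x ≤ suc d → link x ≡ true
  link-of x 2≤x x≤ = trans (link≡ x) (interval-complete 2≤x x≤)
  to : IsEdge a b K →
    IsEdge a b K′ ⊎ Σ ℕ λ k → 2 ≤ k × k ≤ suc d × ((a ≡ 1 × b ≡ k) ⊎ (a ≡ k × b ≡ 1))
  to e with trans (sym (form a b)) (edgeᵇ-complete a b K e) | a ≟ 1 | b ≟ 1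
  ... | h | yes refl | _        = let (2≤b , b≤) = in-interval b h in inj₂ (b , 2≤b , b≤ , inj₁ (refl , refl))
  ... | h | no a≢1   | yes refl = let (2≤a , a≤) = in-interval a (trans (sym (cone-to-1 link (adj K′) a a≢1)) h)
                                  in inj₂ (a , 2≤a , a≤ , inj₂ (refl , refl))
  ... | h | no a≢1   | no b≢1   =
    inj₁ (edgeᵇ-sound a b K′ (trans (sym (cone-away link (adj K′) a b a≢1 b≢1)) h))
  from : IsEdge a b K′ ⊎ Σ ℕ (λ k → 2 ≤ k × k ≤ suc d × ((a ≡ 1 × b ≡ k) ⊎ (a ≡ k × b ≡ 1))) → IsEdge a b K
  from (inj₁ e) = edgeᵇ-sound a b K (trans (form a b) (trans (cone-away link (adj K′) a b a≢1 b≢1) h))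
    where
    h = edgeᵇ-complete a b K′ e
    a≢1 = ≥2⇒≢1 (proj₁ (proj₁ (IsCone.base-supported isCone a b h)))
    b≢1 = ≥2⇒≢1 (proj₁ (proj₂ (IsCone.base-supported isCone a b h)))
  from (inj₂ (k , 2≤k , k≤ , inj₁ (refl , refl))) =
    edgeᵇ-sound 1 k K (trans (form 1 k) (link-of k 2≤k k≤))
  from (inj₂ (k , 2≤k , k≤ , inj₂ (refl , refl))) =
    edgeᵇ-sound k 1 K (trans (form k 1) (trans (cone-to-1 link (adj K′) k (≥2⇒≢1 2≤k)) (link-of k 2≤k k≤)))

σ-involutive : ∀ v x → σ v (σ v x) ≡ x
σ-involutive v x with x ≡ᵇ 1 in e₁
... | true with v ≡ᵇ 1 in e₂
...   | true  = trans (≡ᵇ⇒≡′ e₂) (sym (≡ᵇ⇒≡′ e₁))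
...   | false rewrite ≡ᵇ-refl v = sym (≡ᵇ⇒≡′ e₁)
σ-involutive v x | false with x ≡ᵇ v in e₃
...   | true  rewrite ≡ᵇ-refl 1 = sym (≡ᵇ⇒≡′ e₃)
...   | false rewrite e₁ | e₃ = refl

σ-v : ∀ v → σ v v ≡ 1
σ-v v with v ≡ᵇ 1 in e
... | true  = ≡ᵇ⇒≡′ e
... | false rewrite ≡ᵇ-refl v = refl

σ-elsewhere : ∀ v x → x ≢ 1 → x ≢ v → σ v x ≡ x
σ-elsewhere v x x≢1 x≢v rewrite ≢⇒≡ᵇ-false x≢1 | ≢⇒≡ᵇ-false x≢v = refl

σ-1-identity : ∀ x → σ 1 x ≡ x
σ-1-identity x with x ≡ᵇ 1 in e
... | true  = sym (≡ᵇ⇒≡′ e)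
... | false = refl

σ≡τ : ∀ v x → σ v x ≡ τ 1 v x
σ≡τ v x with x ≡ᵇ 1
... | true = refl
... | false with x ≡ᵇ v
...   | true  = refl
...   | false = refl

σ-in : ∀ {n v x} → In 1 n v → In 1 n x → In 1 n (σ v x)
σ-in {v = v} {x} v∈ x∈ with x ≡ᵇ 1
... | true = v∈
... | false with x ≡ᵇ v
...   | true  = s≤s z≤n , ≤-trans (proj₁ v∈) (proj₂ v∈)
...   | false = x∈

σ-perm : ∀ n v → In 1 n v → Perm 1 n
σ-perm n v v∈ = record
  { to = σ v ; from = σ v ; to∘from = σ-involutive v ; from∘to = σ-involutive v
  ; to-in = λ x → σ-in v∈ ; from-in = λ x → σ-in v∈ }

count-∘σ : ∀ n v s → In 1 n v → count n (λ x → s (σ v x)) ≡ count n s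
count-∘σ n v s v∈ with v ≟ 1
... | yes refl = count-cong n (λ x → cong s (σ-1-identity x))
... | no v≢1 =
  +-cancelʳ-≡ (old 1 + old v) (sumBelow (suc n) new) (sumBelow (suc n) old)
    (trans (sumBelow-exchange₂ (suc n) new old 1 v (λ 1≡v → v≢1 (sym 1≡v))
                               (s≤s (≤-trans (proj₁ v∈) (proj₂ v∈))) (s≤s (proj₂ v∈)) agree)
           (cong (sumBelow (suc n) old +_)
                 (trans (cong (λ w → old v + bit (s w)) (σ-v v)) (+-comm (old v) (old 1)))))
  where
  old new : ℕ → ℕ
  old x = bit (s x)
  new x = bit (s (σ v x))
  agree : ∀ z → z ≢ 1 → z ≢ v → new z ≡ old z
  agree z z≢1 z≢v = cong (λ w → bit (s w)) (σ-elsewhere v z z≢1 z≢v)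

≡ᵇ-σ : ∀ v x s → (x ≡ᵇ σ v s) ≡ (σ v x ≡ᵇ s)
≡ᵇ-σ v x s =
  trans (sym (≡ᵇ-relabel (σ v) {σ v} (σ-involutive v) x (σ v s))) (cong (σ v x ≡ᵇ_) (σ-involutive v s))

σG-adj : ∀ v G → adj (σG v G) ≗₂ adj G ∘₂ σ v
σG-adj v []            x y = refl
σG-adj v ((s , t) ∷ G) x y
  rewrite ≡ᵇ-σ v x s | ≡ᵇ-σ v y t | ≡ᵇ-σ v x t | ≡ᵇ-σ v y s | σG-adj v G x y = refl

private
  2≤both? : (e : ℕ × ℕ) → Dec (2 ≤ proj₁ e × 2 ≤ proj₂ e)
  2≤both? e = (2 ≤? proj₁ e) ×-dec (2 ≤? proj₂ e)

Gbar-sound : ∀ v G x y → adj (Gbar v G) x y ≡ true → adj (σG v G) x y ≡ true × 2 ≤ x × 2 ≤ y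
Gbar-sound v G x y h with edgeᵇ-sound x y (Gbar v G) h
... | inj₁ e with ∈-filter⁻ 2≤both? {xs = σG v G} e
...   | e′ , (2≤x , 2≤y) = edgeᵇ-complete x y (σG v G) (inj₁ e′) , 2≤x , 2≤y
Gbar-sound v G x y h | inj₂ e with ∈-filter⁻ 2≤both? {xs = σG v G} e
...   | e′ , (2≤y , 2≤x) = edgeᵇ-complete x y (σG v G) (inj₂ e′) , 2≤x , 2≤y

Gbar-complete : ∀ v G x y → adj (σG v G) x y ≡ true → 2 ≤ x → 2 ≤ y → adj (Gbar v G) x y ≡ true
Gbar-complete v G x y h 2≤x 2≤y with edgeᵇ-sound x y (σG v G) h
... | inj₁ e = edgeᵇ-complete x y (Gbar v G) (inj₁ (∈-filter⁺ 2≤both? e (2≤x , 2≤y)))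
... | inj₂ e = edgeᵇ-complete x y (Gbar v G) (inj₂ (∈-filter⁺ 2≤both? e (2≤y , 2≤x)))

module _ {lo hi : ℕ} {H : Graph} (on : IsGraphOn lo hi H) where

  IsGraphOn-loopless : Loopless H
  IsGraphOn-loopless a = ≢true⇒≡false (λ h → no-loop (edgeᵇ-sound a a H h))
    where
    no-loop : ¬ IsEdge a a H
    no-loop (inj₁ e) = proj₁ (All.lookup on e) refl
    no-loop (inj₂ e) = proj₁ (All.lookup on e) refl

  IsGraphOn-supported : SupportedOn lo hi (adj H)
  IsGraphOn-supported x y h with edgeᵇ-sound x y H h
  ... | inj₁ e = let (_ , x∈ , y∈) = All.lookup on e in x∈ , y∈
  ... | inj₂ e = let (_ , y∈ , x∈) = All.lookup on e in x∈ , y∈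

IsShifted⇒ShiftedOn : ∀ {lo hi} K → IsShifted lo hi K → ShiftedOn lo hi (adj K)
IsShifted⇒ShiftedOn K shifted a b a′ b′ h a′∈ b′∈ a′≤a b′≤b a′≢b′ =
  edgeᵇ-complete a′ b′ K (shifted a b a′ b′ (edgeᵇ-sound a b K h) a′∈ b′∈ a′≤a b′≤b a′≢b′)

ShiftedOn⇒IsShifted : ∀ {lo hi} K → ShiftedOn lo hi (adj K) → IsShifted lo hi K
ShiftedOn⇒IsShifted K shifted a b a′ b′ e a′∈ b′∈ a′≤a b′≤b a′≢b′ =
  edgeᵇ-sound a′ b′ K (shifted a b a′ b′ (edgeᵇ-complete a b K e) a′∈ b′∈ a′≤a b′≤b a′≢b′)

range1-suc : ∀ n → range1 (suc n) ≡ range1 n ++ (suc n ∷ [])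
range1-suc n = trans (cong (map suc) (sym (upTo-∷ʳ n))) (map-++ suc (upTo n) (n ∷ []))

length-filter-range1 : ∀ (p : ℕ → Bool) → p 0 ≡ false → ∀ n →
  length (filter (λ t → p t ≟ᴮ true) (range1 n)) ≡ count n p
length-filter-range1 p p0 zero rewrite p0 = refl
length-filter-range1 p p0 (suc n) = begin
  length (filter P (range1 (suc n)))
    ≡⟨ cong (λ l → length (filter P l)) (range1-suc n) ⟩
  length (filter P (range1 n ++ (suc n ∷ [])))
    ≡⟨ cong length (filter-++ P (range1 n) (suc n ∷ [])) ⟩
  length (filter P (range1 n) ++ filter P (suc n ∷ []))
    ≡⟨ length-++ (filter P (range1 n)) ⟩
  length (filter P (range1 n)) + length (filter P (suc n ∷ []))
    ≡⟨ cong₂ _+_ (length-filter-range1 p p0 n) (singleton (suc n)) ⟩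
  count n p + bit (p (suc n))
    ∎
  where
  open ≡-Reasoning
  P = λ t → p t ≟ᴮ true
  singleton : ∀ x → length (filter P (x ∷ [])) ≡ bit (p x)
  singleton x with p x
  ... | true  = refl
  ... | false = refl

-- count ranges over 0, …, n but deg only over 1, …, n, hence the hypothesis at 0.
deg-count : ∀ n G u → adj G u 0 ≡ false → deg n G u ≡ count n (adj G u)
deg-count n G u u≁0 = length-filter-range1 (adj G u) u≁0 n

module StarVertex (n : ℕ) (G : Graph) (v : ℕ) (on : IsGraphOn 1 n G) (v∈ : In 1 n v)
                  (star : IsStarVertex n G v) where
  private
    g l m₀ : Adj
    g  = adj G
    l  = adj (σG v G)
    m₀ = adj (Gbar v G)
    d : ℕ
    d = deg n G v
    g-loopless = IsGraphOn-loopless on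
    g-supported = IsGraphOn-supported on

  l-supported : SupportedOn 1 n l
  l-supported x y h with g-supported (σ v x) (σ v y) (trans (sym (σG-adj v G x y)) h)
  ... | x∈ , y∈ = subst (In 1 n) (σ-involutive v x) (σ-in v∈ x∈) ,
                  subst (In 1 n) (σ-involutive v y) (σ-in v∈ y∈)

  l-irreflexive : Irreflexive l
  l-irreflexive x = trans (σG-adj v G x x) (g-loopless (σ v x))

  l-away : ∀ x y → x ≢ 1 → y ≢ 1 → l x y ≡ m₀ x y
  l-away x y x≢1 y≢1 = ≡true-ext
    (λ h → Gbar-complete v G x y h (≢1⇒≥2 (proj₁ (proj₁ (l-supported x y h))) x≢1)
                                   (≢1⇒≥2 (proj₁ (proj₂ (l-supported x y h))) y≢1))
    (λ h → proj₁ (Gbar-sound v G x y h))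

  l-cone : l ≗₂ cone (l 1) m₀
  l-cone x y with x ≟ 1 | y ≟ 1
  ... | yes refl | _        = refl
  ... | no x≢1   | yes refl = trans (adj-sym (σG v G) x 1) (sym (cone-to-1 (l 1) m₀ x x≢1))
  ... | no x≢1   | no y≢1   = trans (l-away x y x≢1 y≢1) (sym (cone-away (l 1) m₀ x y x≢1 y≢1))

  g-0 : ∀ u → g u 0 ≡ false
  g-0 u = ≢true⇒≡false (λ h → 1+n≰n {0} (proj₁ (proj₂ (g-supported u 0 h))))

  deg-positive : ∀ u t → g u t ≡ true → 0 < deg n G u
  deg-positive u t h = subst (0 <_) (sym (deg-count n G u (g-0 u)))
    (<-≤-trans (subst (0 <_) (cong bit (sym h)) (s≤s z≤n))
               (sumBelow-point≤ (suc n) (λ x → bit (g u x)) t (s≤s (proj₂ (proj₂ (g-supported u t h))))))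

  neighbour-of-v : ∀ u t → u ≢ v → g u t ≡ true → g v u ≡ true
  neighbour-of-v u t u≢v h = trans (adj-sym G v u) (edgeᵇ-complete u v G (star u u≢v (deg-positive u t h)))

  initial-cone : ConeOver n d m₀ l
  initial-cone = record
    { link   = l 1
    ; isCone = record
      { 1∉link         = l-irreflexive 1
      ; link⊆          = λ x h → In1⇒In2 (proj₂ (l-supported 1 x h))
          (λ x≡1 → true≢false (trans (sym h) (trans (cong (l 1) x≡1) (l-irreflexive 1))))
      ; base-supported = λ x y h → let (l-xy , 2≤x , 2≤y) = Gbar-sound v G x y h ; (x∈ , y∈) = l-supported x y l-xy
                                   in (2≤x , proj₂ x∈) , (2≤y , proj₂ y∈)
      ; base-sym       = adj-sym (Gbar v G)
      ; base-irr       = λ x → ≢true⇒≡false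
                               (λ h → true≢false (trans (sym (proj₁ (Gbar-sound v G x x h))) (l-irreflexive x)))
      ; base⊆link      = base⊆link
      }
    ; size   = trans (count-cong n (σG-adj v G 1))
                     (trans (count-∘σ n v (g v) v∈) (sym (deg-count n G v (g-0 v))))
    ; form   = l-cone
    }
    where
    base⊆link : ∀ x y → m₀ x y ≡ true → l 1 x ≡ true
    base⊆link x y h =
      trans (σG-adj v G 1 x) (neighbour-of-v (σ v x) (σ v y) σx≢v (trans (sym (σG-adj v G x y)) l-xy))
      where
      l-xy = proj₁ (Gbar-sound v G x y h)
      σx≢v : σ v x ≢ v
      σx≢v σx≡v = ≥2⇒≢1 (proj₁ (proj₂ (Gbar-sound v G x y h)))
                        (trans (sym (σ-involutive v x)) (trans (cong (σ v) σx≡v) (σ-v v)))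

  -- Because v is a star vertex, Shift_{1v} swaps 1 and v, i.e. it turns G into σ_{1v}(G).
  σ-by-shift : Σ (List (ℕ × ℕ)) λ pre → ValidShifts 1 n pre × shifts pre g ≗₂ l
  σ-by-shift with v ≟ 1
  ... | yes refl = [] , [] ,
    λ x y → trans (cong₂ g (sym (σ-1-identity x)) (sym (σ-1-identity y))) (sym (σG-adj v G x y))
  ... | no v≢1 = (1 , v) ∷ [] , (1<v , (≤-refl , 1≤n) , v∈) ∷ [] ,
    ≗₂-trans (shift-acts-as-τ 1 v 1≢v g (adj-sym G) g-loopless 1⊆v)
             (λ x y → trans (cong₂ g (sym (σ≡τ v x)) (sym (σ≡τ v y))) (sym (σG-adj v G x y)))
    where
    1≢v : 1 ≢ v
    1≢v 1≡v = v≢1 (sym 1≡v)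
    1<v = ≤∧≢⇒< (proj₁ v∈) 1≢v
    1≤n = ≤-trans (proj₁ v∈) (proj₂ v∈)
    1⊆v : ∀ t → t ≢ 1 → t ≢ v → g 1 t ≡ true → g v t ≡ true
    1⊆v t _ t≢v h = neighbour-of-v t 1 t≢v (trans (adj-sym G t 1) h)

  g-relabel : g ≗₂ l ∘₂ σ v
  g-relabel x y =
    trans (cong₂ g (sym (σ-involutive v x)) (sym (σ-involutive v y))) (sym (σG-adj v G (σ v x) (σ v y)))

  Gbar-loopless : Loopless (Gbar v G)
  Gbar-loopless = IsCone.base-irr (ConeOver.isCone initial-cone)

  forward : (K : Graph) → IsCombShifted 1 n G K →
    Σ Graph λ K′ → IsCombShifted 2 n (Gbar v G) K′ × StarProp d K K′
  forward K (ps , vps , refl , K-shifted)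
    with shifts-relabel ps g (σ-perm n v v∈) l vps (adj-sym G) g-loopless g-relabel
           (ShiftedOn-cong K-adj (IsShifted⇒ShiftedOn K K-shifted)) (shifts-supported ps g vps g-supported)
    where
    K-adj : adj K ≗₂ shifts ps g
    K-adj = applyShifts-adj ps G vps g-loopless
  ... | qs , vqs , qs≗ with ConeOver-shifts-on-[1,n] qs vqs initial-cone
  ...   | qs′ , vqs′ , c₀ =
    K′ , (qs′ , vqs′ , refl , ShiftedOn⇒IsShifted K′ (ConeOver-base-shifted c K-shiftedOn)) ,
    ConeOver-StarProp c (ConeOver-interval c (ConeOver-link-downClosed c K-shiftedOn))
    where
    K′ = applyShifts qs′ (Gbar v G)
    K-shiftedOn = IsShifted⇒ShiftedOn K K-shifted
    c : ConeOver n d (adj K′) (adj K)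
    c = ConeOver-cong (≗₂-sym (applyShifts-adj qs′ (Gbar v G) vqs′ Gbar-loopless))
                      (≗₂-trans qs≗ (≗₂-sym (applyShifts-adj ps G vps g-loopless))) c₀

  backward : (K′ : Graph) → IsCombShifted 2 n (Gbar v G) K′ →
    Σ Graph λ K → IsCombShifted 1 n G K × StarProp d K K′
  backward K′ (qs′ , vqs′ , refl , K′-shifted)
    with compress _ c₁ K′-shiftedOn ≤-refl | σ-by-shift
    where
    K′-shiftedOn = IsShifted⇒ShiftedOn K′ K′-shifted
    c₁ : ConeOver n d (adj K′) (shifts qs′ l)
    c₁ = ConeOver-cong (≗₂-sym (applyShifts-adj qs′ (Gbar v G) vqs′ Gbar-loopless)) ≗₂-refl
                       (ConeOver-shifts-on-[2,n] qs′ vqs′ initial-cone)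
  ... | qs₂ , vqs₂ , c₂ , down | pre , vpre , pre≗ =
    K , (ps , vps , refl , ShiftedOn⇒IsShifted K (ConeOver-shifted c link≡ K′-shiftedOn)) ,
    ConeOver-StarProp c link≡
    where
    K′-shiftedOn = IsShifted⇒ShiftedOn K′ K′-shifted
    ps = pre ++ (qs′ ++ qs₂)
    vps = ++⁺ vpre (++⁺ (ValidShifts-weaken vqs′) (ValidShifts-weaken vqs₂))
    K = applyShifts ps G
    K-adj : adj K ≗₂ shifts qs₂ (shifts qs′ l)
    K-adj x y = begin
      adj K x y                              ≡⟨ applyShifts-adj ps G vps g-loopless x y ⟩
      shifts ps g x y                        ≡⟨ cong (λ r → r x y) (shifts-++ pre (qs′ ++ qs₂) g) ⟩
      shifts (qs′ ++ qs₂) (shifts pre g) x y ≡⟨ shifts-cong (qs′ ++ qs₂) pre≗ x y ⟩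
      shifts (qs′ ++ qs₂) l x y              ≡⟨ cong (λ r → r x y) (shifts-++ qs′ qs₂ l) ⟩
      shifts qs₂ (shifts qs′ l) x y          ∎
      where open ≡-Reasoning
    c : ConeOver n d (adj K′) (adj K)
    c = ConeOver-cong ≗₂-refl (≗₂-sym K-adj) c₂
    link≡ = ConeOver-interval c down

lemma4p2 : (n : ℕ) (G : Graph) (v : ℕ) →
    IsGraphOn 1 n G → InInterval 1 n v → IsStarVertex n G v →
    ((K : Graph) → IsCombShifted 1 n G K →
      Σ Graph λ K' → IsCombShifted 2 n (Gbar v G) K' × StarProp (deg n G v) K K')
    × ((K' : Graph) → IsCombShifted 2 n (Gbar v G) K' →
      Σ Graph λ K → IsCombShifted 1 n G K × StarProp (deg n G v) K K')
lemma4p2 n G v on v∈ star = forward , backward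
  where open StarVertex n G v on v∈ star
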